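{- Let $A\in\mathbb{F}_2[x]$ be a nonconstant odd perfect polynomial. Then, in $\mathbb{F}_2(x)$, $$\sum_{D\mid A,\ D\neq 1,\ D\neq A}\frac{\sigma^*(D)}{D}=\frac{\sigma^*(A)}{A}.$$
   Context: A nonzero $A\in\mathbb{F}_2[x]$ is odd if it has no irreducible factor of degree $1$. $\sigma(A)$ is the sum of all divisors of $A$ in $\mathbb{F}_2[x]$; $A$ is perfect if $\sigma(A)=A$. A divisor $D$ of $A$ is unitary if $\gcd(D,A/D)=1$, and $\sigma^*(A)$ is the sum of all unitary divisors of $A$. Sums over $D\mid A$ run over all divisors of $A$ in $\mathbb{F}_2[x]$. -}

module Defs where

open import Data.Bool using (Bool; true; false; if_then_else_; not; _xor_; _∧_)
open import Data.Bool.Properties using () renaming (_≟_ to _≟B_)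
open import Data.List using (List; []; _∷_; map; filterᵇ; length; foldr; concatMap)
open import Data.Bool.ListAction using (any; all)
open import Data.List.Properties using (≡-dec)
open import Data.Nat using (ℕ; zero; suc; _≤_; _∸_)
open import Data.Product using (Σ; _×_; _,_; proj₁; proj₂)
open import Data.Sum using (_⊎_)
open import Relation.Nullary using (¬_; does)
open import Relation.Binary.PropositionalEquality using (_≡_)

-- Polynomials over F₂ = Bool (true = 1, false = 0, addition = xor).
-- A polynomial is its list of coefficients, constant term first:
-- a₀ ∷ a₁ ∷ … represents a₀ + a₁ x + a₂ x² + …
-- Trailing zeros are allowed; 'norm' removes them (canonical form),
-- and polynomial equality is '_≈_' (equal canonical forms).

Poly : Set
Poly = List Bool

norm : Poly → Poly
norm [] = []
norm (b ∷ p) with norm p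
... | [] = if b then true ∷ [] else []
... | q@(_ ∷ _) = b ∷ q

infix 4 _≈_
_≈_ : Poly → Poly → Set
p ≈ q = norm p ≡ norm q

_==_ : Poly → Poly → Bool
p == q = does (≡-dec _≟B_ (norm p) (norm q))

0P 1P : Poly
0P = []
1P = true ∷ []

infixl 6 _+P_
infixl 7 _*P_

_+P_ : Poly → Poly → Poly
[] +P q = q
(a ∷ p) +P [] = a ∷ p
(a ∷ p) +P (b ∷ q) = (a xor b) ∷ (p +P q)

_*P_ : Poly → Poly → Poly
[] *P q = []
(a ∷ p) *P q = (if a then q else []) +P (false ∷ (p *P q))

-- degree (of a nonzero polynomial); deg 0 is set to 0 but never used
deg : Poly → ℕ
deg p = length (norm p) ∸ 1

NonZero : Poly → Set
NonZero p = ¬ (p ≈ 0P)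

Nonconstant : Poly → Set
Nonconstant p = 2 ≤ length (norm p)

infix 4 _∣_
_∣_ : Poly → Poly → Set
d ∣ a = Σ Poly λ q → d *P q ≈ a

-- irreducible: nonconstant, and its only divisors are the units
-- (in F₂[x] the only unit is 1) and the associates of P (only P itself).
Irreducible : Poly → Set
Irreducible p = Nonconstant p × (∀ d → d ∣ p → d ≈ 1P ⊎ d ≈ p)

Odd : Poly → Set
Odd a = NonZero a × (∀ p → Irreducible p → deg p ≡ 1 → ¬ (p ∣ a))

allLists : ℕ → List Poly
allLists zero = [] ∷ []
allLists (suc n) = concatMap (λ p → (false ∷ p) ∷ (true ∷ p) ∷ []) (allLists n)

-- all polynomials (in canonical form) of degree ≤ deg a, each exactly once
-- (including 0)
candidates : Poly → List Poly
candidates a = map norm (allLists (length (norm a)))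

-- boolean divisibility test by bounded search for the cofactor
-- (for a ≠ 0 a cofactor has degree ≤ deg a)
divides? : Poly → Poly → Bool
divides? d a = any (λ q → (d *P q) == a) (candidates a)

divisors : Poly → List Poly
divisors a = filterᵇ (λ d → divides? d a) (candidates a)

-- the cofactor a / d (for d ∣ a, d ≠ 0)
quot : Poly → Poly → Poly
quot a d = foldr (λ q r → if (d *P q) == a then q else r) 0P (candidates a)

coprime? : Poly → Poly → Bool
coprime? d e = all (λ c → not (divides? c e) Data.Bool.∨ (c == 1P)) (divisors d)
  where import Data.Bool

unitaryDivisors : Poly → List Poly
unitaryDivisors a = filterᵇ (λ d → coprime? d (quot a d)) (divisors a)

sumP : List Poly → Poly
sumP = foldr _+P_ 0P

σ : Poly → Poly
σ a = sumP (divisors a)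

σ* : Poly → Poly
σ* a = sumP (unitaryDivisors a)

Perfect : Poly → Set
Perfect a = σ a ≈ a

-- Elements of the fraction field F₂(x), as pairs (numerator , denominator)
-- with nonzero denominator; equality by cross-multiplication.

Frac : Set
Frac = Poly × Poly

infixl 6 _+F_
_+F_ : Frac → Frac → Frac
(a , b) +F (c , d) = (a *P d +P c *P b , b *P d)

infix 4 _≈F_
_≈F_ : Frac → Frac → Set
(a , b) ≈F (c , d) = a *P d ≈ c *P b

sumF : List Frac → Frac
sumF = foldr _+F_ (0P , 1P)

properNontrivialDivisors : Poly → List Poly
properNontrivialDivisors a =
  filterᵇ (λ d → not (d == 1P) ∧ not (d == a)) (divisors a)

-- Write σ*⋆id(A) = Σ_{D ∣ A} σ*(D)·(A/D).  If A = pᵃC with p irreducible and p ∤ C, the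
-- divisors of A are the pⁱE with i ≤ a and E ∣ C, and σ*(pⁱE) = σ*(pⁱ)σ*(E); hence
-- σ(A) = σ(pᵃ)σ(C) and σ*⋆id(A) = σ*⋆id(pᵃ)σ*⋆id(C).  In characteristic 2,
-- σ*⋆id(pᵃ) = σ(pᵃ) + a·pᵃ, and for odd a, 1 + p divides σ(pᵃ), while x divides p or 1 + p.
-- So by induction on the degree, σ*⋆id(A) = σ(A) whenever x divides neither A nor σ(A).
-- For A odd and perfect this gives σ*⋆id(A) = A, that is Σ_{D ∣ A} σ*(D)/D = 1, and
-- removing the terms D = 1 and D = A leaves σ*(A)/A since 1 + 1 = 0.

module Submission where

open import Defs
open import Data.List using (map)
open import Data.Product using (_,_)

open import Level using (0ℓ)
open import Function using (_∘_)
open import Function.Bundles using (mk⇔; Equivalence)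
open import Data.Empty using (⊥; ⊥-elim)
open import Data.Product using (_×_; proj₁; proj₂; Σ)
open import Data.Sum using (_⊎_; inj₁; inj₂)
open import Data.Bool using (Bool; true; false; if_then_else_; not; _xor_; _∧_; _∨_; T)
open import Data.Bool.Properties
  using (xor-comm; xor-assoc; xor-identityʳ; xor-same; T-∧) renaming (_≟_ to _≟B_)
open import Data.Bool.ListAction using (any)
open import Data.Nat as ℕ using (ℕ; zero; suc; _+_; _∸_; _≤_; _<_; z≤n; s≤s)
import Data.Nat.Properties as ℕₚ
open import Data.Nat.Induction using (<-wellFounded)
open import Induction.WellFounded using (Acc; acc)
open import Data.List using (List; []; _∷_; length; concatMap; _++_; replicate; foldr; filterᵇ)
open import Data.List.Properties using (≡-dec; length-++; length-replicate; map-id; map-++; map-∘)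
open import Data.List.Membership.Propositional using (_∈_; find; lose)
open import Data.List.Membership.Propositional.Properties
  using (∈-map⁻; ∈-map⁺; ∈-filter⁻; ∈-filter⁺; ∈-++⁻; ∈-++⁺ˡ; ∈-++⁺ʳ)
open import Data.List.Membership.Propositional.Properties.WithK using (unique∧set⇒bag)
open import Data.List.Relation.Unary.Any using (here; there)
open import Data.List.Relation.Unary.Any.Properties using (any⁺; any⁻)
open import Data.List.Relation.Unary.All as All using (All; []; _∷_)
open import Data.List.Relation.Unary.All.Properties using (all⁺; all⁻)
open import Data.List.Relation.Unary.AllPairs using ([]; _∷_)
open import Data.List.Relation.Unary.Unique.Propositional using (Unique)
import Data.List.Relation.Unary.Unique.Propositional.Properties as Unique
open import Data.List.Relation.Binary.Permutation.Propositional
  using (_↭_; prep; swap) renaming (refl to ↭-refl; trans to ↭-trans)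
import Data.List.Relation.Binary.Permutation.Propositional.Properties as ↭
open import Data.List.Relation.Binary.BagAndSetEquality using (∼bag⇒↭)
open import Relation.Nullary using (¬_; Dec; yes; no)
import Relation.Nullary.Decidable as Dec
open import Relation.Nullary.Decidable using (T?)
open import Relation.Binary.Definitions using (Decidable)
open import Relation.Binary.Bundles using (Setoid)
import Relation.Binary.Reasoning.Setoid as SetoidReasoning
open import Relation.Binary.PropositionalEquality as ≡ using (_≡_; _≢_; cong; cong₂)
open import Algebra.Bundles using (CommutativeSemigroup; CommutativeRing)
import Algebra.Properties.CommutativeSemigroup as CommutativeSemigroupProperties

-- F₂[x] as a commutative ring

-- A record rather than Defs._≈_ so that both sides can be inferred from a proof.
infix 4 _≋_
record _≋_ (p q : Poly) : Set where
  constructor mk≋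
  field ≋⇒≈ : p ≈ q
open _≋_ public

≋-refl : ∀ {p} → p ≋ p
≋-refl = mk≋ ≡.refl

≋-sym : ∀ {p q} → p ≋ q → q ≋ p
≋-sym (mk≋ e) = mk≋ (≡.sym e)

≋-trans : ∀ {p q r} → p ≋ q → q ≋ r → p ≋ r
≋-trans (mk≋ e) (mk≋ f) = mk≋ (≡.trans e f)

coeff : Poly → ℕ → Bool
coeff [] i = false
coeff (a ∷ p) zero = a
coeff (a ∷ p) (suc i) = coeff p i

coeff-norm : ∀ p i → coeff (norm p) i ≡ coeff p i
coeff-norm [] i = ≡.refl
coeff-norm (b ∷ p) i with norm p | coeff-norm p
coeff-norm (true  ∷ p) zero    | [] | _ = ≡.refl
coeff-norm (false ∷ p) zero    | [] | _ = ≡.refl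
coeff-norm (true  ∷ p) (suc i) | [] | h = h i
coeff-norm (false ∷ p) (suc i) | [] | h = h i
coeff-norm (b ∷ p) zero    | _ ∷ _ | _ = ≡.refl
coeff-norm (b ∷ p) (suc i) | _ ∷ _ | h = h i

≋⇒coeff : ∀ {p q} → p ≋ q → ∀ i → coeff p i ≡ coeff q i
≋⇒coeff {p} {q} (mk≋ e) i =
  ≡.trans (≡.sym (coeff-norm p i)) (≡.trans (cong (λ r → coeff r i) e) (coeff-norm q i))

consₙ : Bool → Poly → Poly
consₙ b [] = if b then true ∷ [] else []
consₙ b (c ∷ q) = b ∷ c ∷ q

norm-∷ : ∀ b p → norm (b ∷ p) ≡ consₙ b (norm p)
norm-∷ b p with norm p
... | [] = ≡.refl
... | _ ∷ _ = ≡.refl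

∷-cong : ∀ b {p q} → p ≋ q → b ∷ p ≋ b ∷ q
∷-cong b {p} {q} (mk≋ e) = mk≋ (≡.trans (norm-∷ b p) (≡.trans (cong (consₙ b) e) (≡.sym (norm-∷ b q))))

false∷-≋0 : ∀ {p} → p ≋ 0P → false ∷ p ≋ 0P
false∷-≋0 e = ≋-trans (∷-cong false e) (mk≋ ≡.refl)

coeff-ext : ∀ p q → (∀ i → coeff p i ≡ coeff q i) → p ≋ q
coeff-ext [] [] h = mk≋ ≡.refl
coeff-ext [] (b ∷ q) h with h zero
... | ≡.refl = ≋-trans (≋-sym (false∷-≋0 ≋-refl)) (∷-cong false (coeff-ext [] q (λ i → h (suc i))))
coeff-ext (a ∷ p) [] h with h zero
... | ≡.refl = false∷-≋0 (coeff-ext p [] (λ i → h (suc i)))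
coeff-ext (a ∷ p) (b ∷ q) h with h zero
... | ≡.refl = ∷-cong a (coeff-ext p q (λ i → h (suc i)))

≋-setoid : Setoid 0ℓ 0ℓ
≋-setoid = record
  { Carrier = Poly ; _≈_ = _≋_
  ; isEquivalence = record { refl = ≋-refl ; sym = ≋-sym ; trans = ≋-trans } }

module ≋-Reasoning = SetoidReasoning ≋-setoid

≡⇒≋ : ∀ {p q} → p ≡ q → p ≋ q
≡⇒≋ ≡.refl = ≋-refl

coeff-+ : ∀ p q i → coeff (p +P q) i ≡ (coeff p i xor coeff q i)
coeff-+ [] q i = ≡.refl
coeff-+ (a ∷ p) [] i = ≡.sym (xor-identityʳ (coeff (a ∷ p) i))
coeff-+ (a ∷ p) (b ∷ q) zero = ≡.refl
coeff-+ (a ∷ p) (b ∷ q) (suc i) = coeff-+ p q i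

module _ where
  open ≡.≡-Reasoning

  +-cong : ∀ {p p′ q q′} → p ≋ p′ → q ≋ q′ → p +P q ≋ p′ +P q′
  +-cong {p} {p′} {q} {q′} e f = coeff-ext _ _ λ i → begin
    coeff (p +P q) i              ≡⟨ coeff-+ p q i ⟩
    coeff p i xor coeff q i       ≡⟨ cong₂ _xor_ (≋⇒coeff e i) (≋⇒coeff f i) ⟩
    coeff p′ i xor coeff q′ i     ≡⟨ coeff-+ p′ q′ i ⟨
    coeff (p′ +P q′) i            ∎

  +-comm : ∀ p q → p +P q ≋ q +P p
  +-comm p q = coeff-ext _ _ λ i → begin
    coeff (p +P q) i              ≡⟨ coeff-+ p q i ⟩
    coeff p i xor coeff q i       ≡⟨ xor-comm (coeff p i) (coeff q i) ⟩
    coeff q i xor coeff p i       ≡⟨ coeff-+ q p i ⟨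
    coeff (q +P p) i              ∎

  +-assoc : ∀ p q r → (p +P q) +P r ≋ p +P (q +P r)
  +-assoc p q r = coeff-ext _ _ λ i → begin
    coeff ((p +P q) +P r) i                     ≡⟨ coeff-+ (p +P q) r i ⟩
    coeff (p +P q) i xor coeff r i              ≡⟨ cong (_xor coeff r i) (coeff-+ p q i) ⟩
    (coeff p i xor coeff q i) xor coeff r i     ≡⟨ xor-assoc (coeff p i) (coeff q i) (coeff r i) ⟩
    coeff p i xor (coeff q i xor coeff r i)     ≡⟨ cong (coeff p i xor_) (coeff-+ q r i) ⟨
    coeff p i xor coeff (q +P r) i              ≡⟨ coeff-+ p (q +P r) i ⟨
    coeff (p +P (q +P r)) i                     ∎

  +-self : ∀ p → p +P p ≋ 0P
  +-self p = coeff-ext _ _ λ i → ≡.trans (coeff-+ p p i) (xor-same (coeff p i))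

+-identityˡ : ∀ p → 0P +P p ≋ p
+-identityˡ p = ≋-refl

+-identityʳ : ∀ p → p +P 0P ≋ p
+-identityʳ [] = ≋-refl
+-identityʳ (a ∷ p) = ≋-refl

+-commutativeSemigroup : CommutativeSemigroup 0ℓ 0ℓ
+-commutativeSemigroup = record
  { Carrier = Poly ; _≈_ = _≋_ ; _∙_ = _+P_
  ; isCommutativeSemigroup = record
    { isSemigroup = record
      { isMagma = record { isEquivalence = Setoid.isEquivalence ≋-setoid ; ∙-cong = +-cong }
      ; assoc = +-assoc }
    ; comm = +-comm } }

open CommutativeSemigroupProperties +-commutativeSemigroup public
  using () renaming (interchange to +-interchange; x∙yz≈y∙xz to +-swapˡ)

norm-*ˡ : ∀ p q → norm p *P q ≋ p *P q
norm-*ˡ [] q = ≋-refl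
norm-*ˡ (b ∷ p) q = begin
  norm (b ∷ p) *P q       ≡⟨ cong (_*P q) (norm-∷ b p) ⟩
  consₙ b (norm p) *P q   ≈⟨ consₙ-* b (norm p) ⟩
  (b ∷ norm p) *P q       ≈⟨ +-cong ≋-refl (∷-cong false (norm-*ˡ p q)) ⟩
  (b ∷ p) *P q            ∎
  where
  open ≋-Reasoning
  consₙ-* : ∀ b r → consₙ b r *P q ≋ (b ∷ r) *P q
  consₙ-* true  []      = ≋-refl
  consₙ-* false []      = mk≋ ≡.refl
  consₙ-* b     (_ ∷ _) = ≋-refl

*-congˡ : ∀ {p p′} q → p ≋ p′ → p *P q ≋ p′ *P q
*-congˡ {p} {p′} q (mk≋ e) =
  ≋-trans (≋-sym (norm-*ˡ p q)) (≋-trans (≡⇒≋ (cong (_*P q) e)) (norm-*ˡ p′ q))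

*-congʳ : ∀ p {q q′} → q ≋ q′ → p *P q ≋ p *P q′
*-congʳ [] e = ≋-refl
*-congʳ (true  ∷ p) e = +-cong e (∷-cong false (*-congʳ p e))
*-congʳ (false ∷ p) e = ∷-cong false (*-congʳ p e)

*-cong : ∀ {p p′ q q′} → p ≋ p′ → q ≋ q′ → p *P q ≋ p′ *P q′
*-cong {p′ = p′} {q = q} e f = ≋-trans (*-congˡ q e) (*-congʳ p′ f)

*-zeroʳ : ∀ p → p *P 0P ≋ 0P
*-zeroʳ [] = ≋-refl
*-zeroʳ (true  ∷ p) = false∷-≋0 (*-zeroʳ p)
*-zeroʳ (false ∷ p) = false∷-≋0 (*-zeroʳ p)

*-identityˡ : ∀ p → 1P *P p ≋ p
*-identityˡ p = ≋-trans (+-cong ≋-refl (false∷-≋0 ≋-refl)) (+-identityʳ p)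

*-distribʳ : ∀ q p p′ → (p +P p′) *P q ≋ p *P q +P p′ *P q
*-distribʳ q [] p′ = ≋-refl
*-distribʳ q (a ∷ p) [] = ≋-sym (+-identityʳ _)
*-distribʳ q (a ∷ p) (b ∷ p′) =
  ≋-trans (+-cong (scale-xor a b) (∷-cong false (*-distribʳ q p p′)))
          (+-interchange (if a then q else 0P) (if b then q else 0P) _ _)
  where
  scale-xor : ∀ a b → (if a xor b then q else 0P) ≋ (if a then q else 0P) +P (if b then q else 0P)
  scale-xor true  true  = ≋-sym (+-self q)
  scale-xor true  false = ≋-sym (+-identityʳ q)
  scale-xor false b     = ≋-refl

*-distribˡ : ∀ p q q′ → p *P (q +P q′) ≋ p *P q +P p *P q′
*-distribˡ [] q q′ = ≋-refl
*-distribˡ (true  ∷ p) q q′ =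
  ≋-trans (+-cong ≋-refl (∷-cong false (*-distribˡ p q q′))) (+-interchange q q′ _ _)
*-distribˡ (false ∷ p) q q′ = ∷-cong false (*-distribˡ p q q′)

*-consʳ : ∀ p b q → p *P (b ∷ q) ≋ (if b then p else 0P) +P (false ∷ p *P q)
*-consʳ [] true  q = mk≋ ≡.refl
*-consʳ [] false q = mk≋ ≡.refl
*-consʳ (a ∷ p) b q = ≋-trans (+-cong ≋-refl (∷-cong false (*-consʳ p b q))) (shift a b)
  where
  r : Poly
  r = false ∷ p *P q
  shift : ∀ a b → (if a then b ∷ q else 0P) +P (false ∷ ((if b then p else 0P) +P r))
                ≋ (if b then a ∷ p else 0P) +P (false ∷ ((if a then q else 0P) +P r))
  shift true  true  = ∷-cong true (+-swapˡ q p r)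
  shift true  false = ≋-refl
  shift false true  = ≋-refl
  shift false false = ≋-refl

*-comm : ∀ p q → p *P q ≋ q *P p
*-comm [] q = ≋-sym (*-zeroʳ q)
*-comm (a ∷ p) q = ≋-trans (+-cong ≋-refl (∷-cong false (*-comm p q))) (≋-sym (*-consʳ q a p))

*-identityʳ : ∀ p → p *P 1P ≋ p
*-identityʳ p = ≋-trans (*-comm p 1P) (*-identityˡ p)

*-assoc : ∀ p q r → (p *P q) *P r ≋ p *P (q *P r)
*-assoc [] q r = ≋-refl
*-assoc (a ∷ p) q r =
  ≋-trans (*-distribʳ r (if a then q else 0P) (false ∷ p *P q))
          (+-cong (scale-* a) (∷-cong false (*-assoc p q r)))
  where
  scale-* : ∀ a → (if a then q else 0P) *P r ≋ (if a then q *P r else 0P)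
  scale-* true  = ≋-refl
  scale-* false = ≋-refl

PolyRing : CommutativeRing 0ℓ 0ℓ
PolyRing = record
  { Carrier = Poly ; _≈_ = _≋_ ; _+_ = _+P_ ; _*_ = _*P_ ; -_ = λ p → p ; 0# = 0P ; 1# = 1P
  ; isCommutativeRing = record
    { isRing = record
      { +-isAbelianGroup = record
        { isGroup = record
          { isMonoid = record
            { isSemigroup = CommutativeSemigroup.isSemigroup +-commutativeSemigroup
            ; identity = +-identityˡ , +-identityʳ }
          ; inverse = +-self , +-self
          ; ⁻¹-cong = λ e → e }
        ; comm = +-comm }
      ; *-cong = *-cong
      ; *-assoc = *-assoc
      ; *-identity = *-identityˡ , *-identityʳ
      ; distrib = *-distribˡ , *-distribʳ }
    ; *-comm = *-comm } }

open CommutativeSemigroupProperties (CommutativeRing.*-commutativeSemigroup PolyRing) public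
  using () renaming (interchange to *-interchange; x∙yz≈y∙xz to *-swapˡ)

-- The ring solver with F₂ = (Bool, xor, ∧) as coefficients, so it knows that 1 + 1 = 0.
module PolySolver where
  open import Algebra.Solver.Ring.AlmostCommutativeRing
    using (fromCommutativeRing; _-Raw-AlmostCommutative⟶_)
  open import Data.Bool.Properties using (xor-∧-commutativeRing; _≟_)
  open import Data.Maybe using (Maybe; just; nothing)
  open import Relation.Nullary using (yes; no)

  embed : Bool → Poly
  embed b = if b then 1P else 0P

  embed-homomorphism : CommutativeRing.rawRing xor-∧-commutativeRing
                         -Raw-AlmostCommutative⟶ fromCommutativeRing PolyRing
  embed-homomorphism = record
    { ⟦_⟧ = embed
    ; +-homo = +-homo
    ; *-homo = *-homo
    ; -‿homo = λ _ → ≋-refl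
    ; 0-homo = ≋-refl
    ; 1-homo = ≋-refl }
    where
    +-homo : ∀ a b → embed (a xor b) ≋ embed a +P embed b
    +-homo true  true  = ≋-sym (+-self 1P)
    +-homo true  false = ≋-refl
    +-homo false b     = ≋-refl
    *-homo : ∀ a b → embed (a ∧ b) ≋ embed a *P embed b
    *-homo true  b = ≋-sym (*-identityˡ (embed b))
    *-homo false b = ≋-refl

  embed-equal? : ∀ a b → Maybe (embed a ≋ embed b)
  embed-equal? a b with a ≟ b
  ... | yes ≡.refl = just ≋-refl
  ... | no _ = nothing

  open import Algebra.Solver.Ring _ _ embed-homomorphism embed-equal? public

-- deg p + 1 for p ≠ 0, and 0 for p = 0.
len : Poly → ℕ
len p = length (norm p)

≋⇒len≡ : ∀ {p q} → p ≋ q → len p ≡ len q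
≋⇒len≡ (mk≋ e) = cong length e

_≋?_ : Decidable _≋_
p ≋? q = Dec.map′ mk≋ ≋⇒≈ (≡-dec _≟B_ (norm p) (norm q))

len≡0⇒≋0 : ∀ p → len p ≡ 0 → p ≋ 0P
len≡0⇒≋0 p e with norm p in eq
... | [] = mk≋ eq

≉0⇒len≡suc : ∀ p → ¬ p ≋ 0P → Σ ℕ λ m → len p ≡ suc m
≉0⇒len≡suc p p≉0 with len p in eq
... | zero = ⊥-elim (p≉0 (len≡0⇒≋0 p eq))
... | suc m = m , ≡.refl

len≡suc⇒≉0 : ∀ {p m} → len p ≡ suc m → ¬ p ≋ 0P
len≡suc⇒≉0 e p≈0 = ℕₚ.0≢1+n (≡.trans (≡.sym (≋⇒len≡ p≈0)) e)

coeff-≥length : ∀ l i → length l ≤ i → coeff l i ≡ false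
coeff-≥length [] i h = ≡.refl
coeff-≥length (_ ∷ l) (suc i) (s≤s h) = coeff-≥length l i h

coeff-≥len : ∀ p i → len p ≤ i → coeff p i ≡ false
coeff-≥len p i h = ≡.trans (≡.sym (coeff-norm p i)) (coeff-≥length (norm p) i h)

len-consₙ : ∀ b l → length (consₙ b l) ≤ suc (length l)
len-consₙ true  [] = ℕₚ.≤-refl
len-consₙ false [] = z≤n
len-consₙ b (_ ∷ _) = ℕₚ.≤-refl

len≤ : ∀ p k → (∀ i → k ≤ i → coeff p i ≡ false) → len p ≤ k
len≤ p zero h = ℕₚ.≤-reflexive (≋⇒len≡ (coeff-ext p [] (λ i → h i z≤n)))
len≤ [] (suc k) h = z≤n
len≤ (b ∷ p) (suc k) h rewrite norm-∷ b p =
  ℕₚ.≤-trans (len-consₙ b (norm p)) (s≤s (len≤ p k (λ i k≤i → h (suc i) (s≤s k≤i))))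

coeff-leading : ∀ p m → len p ≡ suc m → coeff p m ≡ true
coeff-leading [] m ()
coeff-leading (b ∷ p) m e with norm p in eq
coeff-leading (true  ∷ p) zero    e | [] = ≡.refl
coeff-leading (true  ∷ p) (suc m) () | []
coeff-leading (false ∷ p) m       () | []
coeff-leading (b ∷ p) (suc m) e | c ∷ r = coeff-leading p m (≡.trans (cong length eq) (ℕₚ.suc-injective e))

len≡suc : ∀ p m → coeff p m ≡ true → (∀ i → suc m ≤ i → coeff p i ≡ false) → len p ≡ suc m
len≡suc p m top h = ℕₚ.≤-antisym (len≤ p (suc m) h) (ℕₚ.≰⇒> below)
  where
  below : ¬ len p ≤ m
  below l≤m with ≡.trans (≡.sym top) (coeff-≥len p m l≤m)
  ... | ()

len≡1⇒≋1 : ∀ p → len p ≡ 1 → p ≋ 1P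
len≡1⇒≋1 p e = coeff-ext p 1P λ
  { zero → coeff-leading p 0 e
  ; (suc i) → coeff-≥len p (suc i) (ℕₚ.≤-trans (ℕₚ.≤-reflexive e) (s≤s z≤n)) }

len-+-≤ : ∀ p q k → len p ≤ k → len q ≤ k → len (p +P q) ≤ k
len-+-≤ p q k hp hq = len≤ (p +P q) k λ i k≤i →
  ≡.trans (coeff-+ p q i) (cong₂ _xor_ (coeff-≥len p i (ℕₚ.≤-trans hp k≤i)) (coeff-≥len q i (ℕₚ.≤-trans hq k≤i)))

-- In characteristic 2 the leading terms of two polynomials of the same degree cancel.
len-+-cancel : ∀ p q m → len p ≡ suc m → len q ≡ suc m → len (p +P q) ≤ m
len-+-cancel p q m ep eq = len≤ (p +P q) m vanish
  where
  vanish : ∀ i → m ≤ i → coeff (p +P q) i ≡ false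
  vanish i m≤i with m ℕ.≟ i
  ... | yes ≡.refl = ≡.trans (coeff-+ p q m) (cong₂ _xor_ (coeff-leading p m ep) (coeff-leading q m eq))
  ... | no m≢i = coeff-≥len (p +P q) i
    (ℕₚ.≤-trans (len-+-≤ p q (suc m) (ℕₚ.≤-reflexive ep) (ℕₚ.≤-reflexive eq)) (ℕₚ.≤∧≢⇒< m≤i m≢i))

len-+-< : ∀ p q → len p < len q → len (p +P q) ≡ len q
len-+-< p q lt with len q in eq
... | suc m = len≡suc (p +P q) m leading vanish
  where
  leading : coeff (p +P q) m ≡ true
  leading = ≡.trans (coeff-+ p q m) (cong₂ _xor_ (coeff-≥len p m (ℕₚ.≤-pred lt)) (coeff-leading q m eq))
  vanish : ∀ i → suc m ≤ i → coeff (p +P q) i ≡ false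
  vanish i m<i = coeff-≥len (p +P q) i (ℕₚ.≤-trans (len-+-≤ p q (suc m) (ℕₚ.<⇒≤ lt) (ℕₚ.≤-reflexive eq)) m<i)

len-∷ : ∀ b p m → len p ≡ suc m → len (b ∷ p) ≡ suc (suc m)
len-∷ b p m e rewrite norm-∷ b p with norm p
... | _ ∷ _ = cong suc e

len-∷-≤ : ∀ b p → len (b ∷ p) ≤ suc (len p)
len-∷-≤ b p rewrite norm-∷ b p = len-consₙ b (norm p)

len-∷-0 : ∀ b p → len p ≡ 0 → len (b ∷ p) ≡ (if b then 1 else 0)
len-∷-0 b p e rewrite norm-∷ b p with norm p
len-∷-0 true  p e | [] = ≡.refl
len-∷-0 false p e | [] = ≡.refl

len-scale : ∀ a q → len (if a then q else 0P) ≤ len q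
len-scale true  q = ℕₚ.≤-refl
len-scale false q = z≤n

len-* : ∀ p q m n → len p ≡ suc m → len q ≡ suc n → len (p *P q) ≡ suc (m + n)
len-* (a ∷ p) q m n ep eq with len p in e
len-* (a ∷ p) q m n ep eq | zero with ≡.trans (≡.sym (len-∷-0 a p e)) ep
len-* (true ∷ p) q zero n ep eq | zero | ≡.refl =
  ≡.trans (≋⇒len≡ (≋-trans (+-cong (≋-refl {q}) (false∷-≋0 (*-congˡ q (len≡0⇒≋0 p e)))) (+-identityʳ q))) eq
len-* (a ∷ p) q m n ep eq | suc m′ with ≡.trans (≡.sym (len-∷ a p m′ e)) ep
... | ≡.refl = ≡.trans (len-+-< (if a then q else 0P) (false ∷ p *P q) shorter) len-shifted
  where
  len-shifted : len (false ∷ p *P q) ≡ suc (suc m′ + n)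
  len-shifted = len-∷ false (p *P q) (m′ + n) (len-* p q m′ n e eq)
  shorter : len (if a then q else 0P) < len (false ∷ p *P q)
  shorter = begin-strict
    len (if a then q else 0P)  ≤⟨ len-scale a q ⟩
    len q                      ≡⟨ eq ⟩
    suc n                      <⟨ s≤s (s≤s (ℕₚ.m≤n+m n m′)) ⟩
    suc (suc m′ + n)           ≡⟨ len-shifted ⟨
    len (false ∷ p *P q)       ∎
    where open ℕₚ.≤-Reasoning

*-≉0 : ∀ {p q} → ¬ p ≋ 0P → ¬ q ≋ 0P → ¬ p *P q ≋ 0P
*-≉0 {p} {q} p≉0 q≉0 with ≉0⇒len≡suc p p≉0 | ≉0⇒len≡suc q q≉0
... | m , em | n , en = len≡suc⇒≉0 (len-* p q m n em en)

-- Divisibility, division with remainder and Euclid's lemma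

-- Defs._∣_ as a record, for the same reason as _≋_.
infix 4 _∣ₚ_
record _∣ₚ_ (d a : Poly) : Set where
  constructor divides
  field
    quotient : Poly
    equality : d *P quotient ≋ a
open _∣ₚ_ public

∣⇒∣ₚ : ∀ {d a} → d ∣ a → d ∣ₚ a
∣⇒∣ₚ (q , e) = divides q (mk≋ e)

∣ₚ⇒∣ : ∀ {d a} → d ∣ₚ a → d ∣ a
∣ₚ⇒∣ (divides q e) = q , ≋⇒≈ e

∣ₚ-refl : ∀ {a} → a ∣ₚ a
∣ₚ-refl {a} = divides 1P (*-identityʳ a)

≋⇒∣ₚ : ∀ {a b} → a ≋ b → a ∣ₚ b
≋⇒∣ₚ {a} e = divides 1P (≋-trans (*-identityʳ a) e)

∣ₚ-trans : ∀ {a b c} → a ∣ₚ b → b ∣ₚ c → a ∣ₚ c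
∣ₚ-trans {a} (divides q e) (divides q′ e′) =
  divides (q *P q′) (≋-trans (≋-sym (*-assoc a q q′)) (≋-trans (*-congˡ q′ e) e′))

∣ₚ-respʳ : ∀ {a b b′} → b ≋ b′ → a ∣ₚ b → a ∣ₚ b′
∣ₚ-respʳ e (divides q e′) = divides q (≋-trans e′ e)

∣ₚ-respˡ : ∀ {a a′ b} → a ≋ a′ → a ∣ₚ b → a′ ∣ₚ b
∣ₚ-respˡ e (divides q e′) = divides q (≋-trans (*-congˡ q (≋-sym e)) e′)

p∣p*q : ∀ p q → p ∣ₚ p *P q
p∣p*q p q = divides q ≋-refl

p∣q*p : ∀ p q → p ∣ₚ q *P p
p∣q*p p q = divides q (*-comm p q)

∣p⇒∣p*q : ∀ {d p} q → d ∣ₚ p → d ∣ₚ p *P q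
∣p⇒∣p*q {p = p} q d∣p = ∣ₚ-trans d∣p (p∣p*q p q)

∣p⇒∣q*p : ∀ {d p} q → d ∣ₚ p → d ∣ₚ q *P p
∣p⇒∣q*p {p = p} q d∣p = ∣ₚ-trans d∣p (p∣q*p p q)

∣p∣q⇒∣p+q : ∀ {d p q} → d ∣ₚ p → d ∣ₚ q → d ∣ₚ p +P q
∣p∣q⇒∣p+q {d} (divides k e) (divides k′ e′) =
  divides (k +P k′) (≋-trans (*-distribˡ d k k′) (+-cong e e′))

1∣ₚ : ∀ a → 1P ∣ₚ a
1∣ₚ a = divides a (*-identityˡ a)

∣ₚ⇒≉0 : ∀ {d a} → d ∣ₚ a → ¬ a ≋ 0P → ¬ d ≋ 0P
∣ₚ⇒≉0 (divides q e) a≉0 d≈0 = a≉0 (≋-trans (≋-sym e) (*-congˡ q d≈0))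

quotient-≉0 : ∀ {d a} (d∣a : d ∣ₚ a) → ¬ a ≋ 0P → ¬ quotient d∣a ≋ 0P
quotient-≉0 {d} (divides q e) = ∣ₚ⇒≉0 (divides d (≋-trans (*-comm q d) e))

∣ₚ⇒len≤ : ∀ {d a} → d ∣ₚ a → ¬ a ≋ 0P → len d ≤ len a
∣ₚ⇒len≤ {d} {a} d∣a@(divides q e) a≉0
  with ≉0⇒len≡suc d (∣ₚ⇒≉0 d∣a a≉0) | ≉0⇒len≡suc q (quotient-≉0 d∣a a≉0)
... | m , em | n , en =
  ℕₚ.≤-trans (ℕₚ.≤-reflexive em)
    (ℕₚ.≤-trans (s≤s (ℕₚ.m≤m+n m n)) (ℕₚ.≤-reflexive (≡.trans (≡.sym (len-* d q m n em en)) (≋⇒len≡ e))))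

*-cancelˡ : ∀ p {q r} → ¬ p ≋ 0P → p *P q ≋ p *P r → q ≋ r
*-cancelˡ p {q} {r} p≉0 e with (q +P r) ≋? 0P
... | yes q+r≈0 = ≋-trans (solve 2 (λ q r → q := (q :+ r) :+ r) ≋-refl q r)
                          (≋-trans (+-cong q+r≈0 ≋-refl) (+-identityˡ r))
  where open PolySolver
... | no q+r≉0 = ⊥-elim (*-≉0 p≉0 q+r≉0
        (≋-trans (*-distribˡ p q r) (≋-trans (+-cong e ≋-refl) (+-self (p *P r)))))

record DivMod (a b : Poly) : Set where
  constructor result
  field
    quo rem : Poly
    property : a ≋ b *P quo +P rem
    rem<b : len rem < len b

divMod : ∀ a b → ¬ b ≋ 0P → DivMod a b
divMod [] b b≉0 with ≉0⇒len≡suc b b≉0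
... | m , eb = result 0P 0P (≋-sym (≋-trans (+-identityʳ _) (*-zeroʳ b)))
                            (ℕₚ.≤-trans (s≤s z≤n) (ℕₚ.≤-reflexive (≡.sym eb)))
divMod (c ∷ a) b b≉0 with divMod a b b≉0 | ≉0⇒len≡suc b b≉0
... | result q r a≈bq+r r<b | m , eb = fix (ℕₚ.m≤n⇒m<n∨m≡n R≤b)
  where
  open PolySolver
  C R : Poly
  C = if c then 1P else 0P
  R = C +P (false ∷ r)
  shifted : c ∷ a ≋ b *P (false ∷ q) +P R
  shifted = begin
    c ∷ a                             ≈⟨ split c ⟩
    C +P (false ∷ a)                  ≈⟨ +-cong ≋-refl (∷-cong false a≈bq+r) ⟩
    C +P ((false ∷ b *P q) +P (false ∷ r))  ≈⟨ +-swapˡ C (false ∷ b *P q) (false ∷ r) ⟩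
    (false ∷ b *P q) +P R             ≈⟨ +-cong (≋-sym (*-consʳ b false q)) ≋-refl ⟩
    b *P (false ∷ q) +P R             ∎
    where
    open ≋-Reasoning
    split : ∀ c → c ∷ a ≋ (if c then 1P else 0P) +P (false ∷ a)
    split true  = ≋-refl
    split false = ≋-refl
  R≤b : len R ≤ len b
  R≤b = len-+-≤ C (false ∷ r) (len b)
          (ℕₚ.≤-trans (len-C c) (ℕₚ.≤-trans (s≤s z≤n) (ℕₚ.≤-reflexive (≡.sym eb))))
          (ℕₚ.≤-trans (len-∷-≤ false r) r<b)
    where
    len-C : ∀ c → len (if c then 1P else 0P) ≤ 1
    len-C true  = ℕₚ.≤-refl
    len-C false = z≤n
  fix : len R < len b ⊎ len R ≡ len b → DivMod (c ∷ a) b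
  fix (inj₁ R<b) = result (false ∷ q) R shifted R<b
  fix (inj₂ R≡b) = result ((false ∷ q) +P 1P) (R +P b)
    (≋-trans shifted (solve 3 (λ b q r → b :* q :+ r := b :* (q :+ con true) :+ (r :+ b)) ≋-refl b (false ∷ q) R))
    (ℕₚ.≤-trans (s≤s (len-+-cancel R b m (≡.trans R≡b eb) eb)) (ℕₚ.≤-reflexive (≡.sym eb)))

record Bézout (a b : Poly) : Set where
  field
    gcd u v : Poly
    gcd∣a : gcd ∣ₚ a
    gcd∣b : gcd ∣ₚ b
    identity : gcd ≋ u *P a +P v *P b

bézout : ∀ a b → Bézout a b
bézout a b = go a b (<-wellFounded (len b))
  where
  open PolySolver
  go : ∀ a b → Acc _<_ (len b) → Bézout a b
  go a b (acc rec) with b ≋? 0P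
  ... | yes b≈0 = record
    { gcd = a ; u = 1P ; v = 0P ; gcd∣a = ∣ₚ-refl
    ; gcd∣b = divides 0P (≋-trans (*-zeroʳ a) (≋-sym b≈0))
    ; identity = ≋-sym (≋-trans (+-identityʳ _) (*-identityˡ a)) }
  ... | no b≉0 with divMod a b b≉0
  ... | result q r a≈bq+r r<b = record
    { gcd = gcd ; u = v ; v = u +P v *P q
    ; gcd∣a = ∣ₚ-respʳ (≋-sym a≈bq+r) (∣p∣q⇒∣p+q (∣p⇒∣p*q q gcd∣a) gcd∣b)
    ; gcd∣b = gcd∣a
    ; identity = ≋-trans identity (≋-trans (+-cong ≋-refl (*-congʳ v r≈a+bq))
        (solve 5 (λ u v a b q → u :* b :+ v :* (a :+ b :* q) := v :* a :+ (u :+ v :* q) :* b) ≋-refl u v a b q)) }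
    where
    open Bézout (go b r (rec r<b))
    r≈a+bq : r ≋ a +P b *P q
    r≈a+bq = ≋-trans (solve 2 (λ x r → r := (x :+ r) :+ x) ≋-refl (b *P q) r) (+-cong (≋-sym a≈bq+r) ≋-refl)

irreducible-divisor : ∀ {p d} → Irreducible p → d ∣ₚ p → d ≋ 1P ⊎ d ≋ p
irreducible-divisor {d = d} (_ , only) d∣p with only d (∣ₚ⇒∣ d∣p)
... | inj₁ e = inj₁ (mk≋ e)
... | inj₂ e = inj₂ (mk≋ e)

euclidsLemma : ∀ {p} B C → Irreducible p → p ∣ₚ B *P C → ¬ p ∣ₚ B → p ∣ₚ C
euclidsLemma {p} B C p-irr p∣BC p∤B = from-gcd (irreducible-divisor p-irr gcd∣a)
  where
  open Bézout (bézout p B)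
  open PolySolver
  from-gcd : gcd ≋ 1P ⊎ gcd ≋ p → p ∣ₚ C
  from-gcd (inj₂ gcd≈p) = ⊥-elim (p∤B (∣ₚ-trans (≋⇒∣ₚ (≋-sym gcd≈p)) gcd∣b))
  from-gcd (inj₁ gcd≈1) = ∣ₚ-respʳ C≈ (∣p∣q⇒∣p+q (p∣p*q p (u *P C)) (∣p⇒∣q*p v p∣BC))
    where
    C≈ : p *P (u *P C) +P v *P (B *P C) ≋ C
    C≈ = ≋-trans (solve 5 (λ p u C v B → p :* (u :* C) :+ v :* (B :* C) := (u :* p :+ v :* B) :* C)
                        ≋-refl p u C v B)
                 (≋-trans (*-congˡ C (≋-trans (≋-sym identity) gcd≈1)) (*-identityˡ C))

-- Correctness of the enumerations of divisors

Normal : Poly → Set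
Normal p = norm p ≡ p

norm-idem : ∀ p → Normal (norm p)
norm-idem p = ≋⇒≈ (coeff-ext (norm p) p (coeff-norm p))

norm-≋ : ∀ p → norm p ≋ p
norm-≋ p = mk≋ (norm-idem p)

≋⇒≡ : ∀ {p q} → Normal p → Normal q → p ≋ q → p ≡ q
≋⇒≡ np nq (mk≋ e) = ≡.trans (≡.sym np) (≡.trans e nq)

==⇒≋ : ∀ {p q} → T (p == q) → p ≋ q
==⇒≋ {p} {q} h with ≡-dec _≟B_ (norm p) (norm q)
... | yes e = mk≋ e

≋⇒== : ∀ {p q} → p ≋ q → T (p == q)
≋⇒== {p} {q} (mk≋ e) with ≡-dec _≟B_ (norm p) (norm q)
... | yes _ = _
... | no e≢ = e≢ e

len-norm≤length : ∀ l → len l ≤ length l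
len-norm≤length l = len≤ l (length l) (coeff-≥length l)

map-unique : ∀ (f : Poly → Poly) {L} → (∀ {x y} → x ∈ L → y ∈ L → f x ≡ f y → x ≡ y) →
             Unique L → Unique (map f L)
map-unique f inj [] = []
map-unique f inj (x∉L ∷ u) =
  All.tabulate (λ fy∈ fx≡fy → let (y , y∈ , ≡fy) = ∈-map⁻ f fy∈ in
                 All.lookup x∉L y∈ (inj (here ≡.refl) (there y∈) (≡.trans fx≡fy ≡fy)))
  ∷ map-unique f (λ x∈ y∈ → inj (there x∈) (there y∈)) u

private
  both-heads : Poly → List Poly
  both-heads p = (false ∷ p) ∷ (true ∷ p) ∷ []

  ∈-both-heads⁻ : ∀ L {x} → x ∈ concatMap both-heads L → Σ Bool λ b → Σ Poly λ p → x ≡ b ∷ p × p ∈ L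
  ∈-both-heads⁻ (p ∷ L) (here e) = false , p , e , here ≡.refl
  ∈-both-heads⁻ (p ∷ L) (there (here e)) = true , p , e , here ≡.refl
  ∈-both-heads⁻ (p ∷ L) (there (there x∈)) =
    let (b , q , e , q∈) = ∈-both-heads⁻ L x∈ in b , q , e , there q∈

  ∈-both-heads⁺ : ∀ {L} b {p} → p ∈ L → b ∷ p ∈ concatMap both-heads L
  ∈-both-heads⁺ false (here ≡.refl) = here ≡.refl
  ∈-both-heads⁺ true  (here ≡.refl) = there (here ≡.refl)
  ∈-both-heads⁺ b (there p∈) = there (there (∈-both-heads⁺ b p∈))

  both-heads-unique : ∀ {L} → Unique L → Unique (concatMap both-heads L)
  both-heads-unique {[]} [] = []
  both-heads-unique {p ∷ L} (p∉L ∷ u) =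
    All.tabulate (λ { (here ≡.refl) () ; (there y∈) → tail-distinct y∈ })
    ∷ All.tabulate tail-distinct
    ∷ both-heads-unique u
    where
    tail-distinct : ∀ {b y} → y ∈ concatMap both-heads L → b ∷ p ≢ y
    tail-distinct y∈ b∷p≡y with ∈-both-heads⁻ L y∈
    ... | _ , q , ≡.refl , q∈ with b∷p≡y
    ... | ≡.refl = All.lookup p∉L q∈ ≡.refl

∈-allLists⁻ : ∀ n {l} → l ∈ allLists n → length l ≡ n
∈-allLists⁻ zero (here ≡.refl) = ≡.refl
∈-allLists⁻ (suc n) l∈ with ∈-both-heads⁻ (allLists n) l∈
... | _ , p , ≡.refl , p∈ = cong suc (∈-allLists⁻ n p∈)

∈-allLists⁺ : ∀ l → l ∈ allLists (length l)
∈-allLists⁺ [] = here ≡.refl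
∈-allLists⁺ (b ∷ l) = ∈-both-heads⁺ b (∈-allLists⁺ l)

allLists-unique : ∀ n → Unique (allLists n)
allLists-unique zero = [] ∷ []
allLists-unique (suc n) = both-heads-unique (allLists-unique n)

coeff-pad : ∀ l k i → coeff (l ++ replicate k false) i ≡ coeff l i
coeff-pad [] zero i = ≡.refl
coeff-pad [] (suc k) zero = ≡.refl
coeff-pad [] (suc k) (suc i) = coeff-pad [] k i
coeff-pad (b ∷ l) k zero = ≡.refl
coeff-pad (b ∷ l) k (suc i) = coeff-pad l k i

coeff-injective : ∀ l l′ → length l ≡ length l′ → (∀ i → coeff l i ≡ coeff l′ i) → l ≡ l′
coeff-injective [] [] _ _ = ≡.refl
coeff-injective (b ∷ l) (b′ ∷ l′) e h =
  cong₂ _∷_ (h zero) (coeff-injective l l′ (ℕₚ.suc-injective e) (λ i → h (suc i)))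

∈-candidates⁻ : ∀ a {x} → x ∈ candidates a → Normal x × len x ≤ len a
∈-candidates⁻ a x∈ with ∈-map⁻ norm x∈
... | l , l∈ , ≡.refl = norm-idem l , (begin
  len (norm l) ≡⟨ ≋⇒len≡ (norm-≋ l) ⟩
  len l        ≤⟨ len-norm≤length l ⟩
  length l     ≡⟨ ∈-allLists⁻ (len a) l∈ ⟩
  len a        ∎)
  where open ℕₚ.≤-Reasoning

∈-candidates⁺ : ∀ a {x} → Normal x → len x ≤ len a → x ∈ candidates a
∈-candidates⁺ a {x} x-normal x≤a =
  ≡.subst (_∈ candidates a) norm-padded
    (∈-map⁺ norm (≡.subst (padded ∈_) (cong allLists length-padded) (∈-allLists⁺ padded)))
  where
  padded : Poly
  padded = x ++ replicate (len a ∸ length x) false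
  length-padded : length padded ≡ len a
  length-padded = ≡.trans (length-++ x) (≡.trans (cong (length x +_) (length-replicate (len a ∸ length x)))
                    (ℕₚ.m+[n∸m]≡n (≡.subst (_≤ len a) (cong length x-normal) x≤a)))
  norm-padded : norm padded ≡ x
  norm-padded = ≡.trans (≋⇒≈ (coeff-ext padded x (coeff-pad x _))) x-normal

candidates-unique : ∀ a → Unique (candidates a)
candidates-unique a = map-unique norm norm-injective (allLists-unique (len a))
  where
  norm-injective : ∀ {l l′} → l ∈ allLists (len a) → l′ ∈ allLists (len a) → norm l ≡ norm l′ → l ≡ l′
  norm-injective {l} {l′} l∈ l′∈ e = coeff-injective l l′
    (≡.trans (∈-allLists⁻ (len a) l∈) (≡.sym (∈-allLists⁻ (len a) l′∈))) (≋⇒coeff {l} {l′} (mk≋ e))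

divides?-sound : ∀ d a → T (divides? d a) → d ∣ₚ a
divides?-sound d a h with find (any⁻ (λ q → (d *P q) == a) (candidates a) h)
... | q , _ , dq==a = divides q (==⇒≋ dq==a)

divides?-complete : ∀ {d a} → ¬ a ≋ 0P → d ∣ₚ a → T (divides? d a)
divides?-complete {d} {a} a≉0 (divides q dq≈a) =
  any⁺ _ (lose norm-q∈ (≋⇒== (≋-trans (*-congʳ d (norm-≋ q)) dq≈a)))
  where
  norm-q∈ : norm q ∈ candidates a
  norm-q∈ = ∈-candidates⁺ a (norm-idem q)
    (ℕₚ.≤-trans (ℕₚ.≤-reflexive (≋⇒len≡ (norm-≋ q)))
                (∣ₚ⇒len≤ {q} (divides d (≋-trans (*-comm q d) dq≈a)) a≉0))

∈-divisors⁻ : ∀ a {d} → d ∈ divisors a → Normal d × d ∣ₚ a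
∈-divisors⁻ a {d} d∈ with ∈-filter⁻ (λ d → T? (divides? d a)) {xs = candidates a} d∈
... | d∈′ , h = proj₁ (∈-candidates⁻ a d∈′) , divides?-sound d a h

∈-divisors⁺ : ∀ {a d} → ¬ a ≋ 0P → Normal d → d ∣ₚ a → d ∈ divisors a
∈-divisors⁺ {a} a≉0 d-normal d∣a =
  ∈-filter⁺ (λ d → T? (divides? d a)) (∈-candidates⁺ a d-normal (∣ₚ⇒len≤ d∣a a≉0)) (divides?-complete a≉0 d∣a)

divisors-unique : ∀ a → Unique (divisors a)
divisors-unique a = Unique.filter⁺ (λ d → T? (divides? d a)) (candidates-unique a)

quot-correct : ∀ {a d} → ¬ a ≋ 0P → d ∣ₚ a → d *P quot a d ≋ a
quot-correct {a} {d} a≉0 d∣a = ==⇒≋ (first-found (candidates a) (divides?-complete a≉0 d∣a))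
  where
  test : Poly → Bool
  test q = (d *P q) == a
  first-found : ∀ L → T (any test L) → T (test (foldr (λ q r → if test q then q else r) 0P L))
  first-found (q ∷ L) h with test q in eq
  ... | true = ≡.subst T (≡.sym eq) _
  ... | false = first-found L h

quot-≉0 : ∀ {a d} → ¬ a ≋ 0P → d ∣ₚ a → ¬ quot a d ≋ 0P
quot-≉0 {a} {d} a≉0 d∣a = quotient-≉0 {d} (divides (quot a d) (quot-correct a≉0 d∣a)) a≉0

quot-unique : ∀ {a d q} → ¬ a ≋ 0P → d *P q ≋ a → quot a d ≋ q
quot-unique {a} {d} {q} a≉0 dq≈a =
  *-cancelˡ d (∣ₚ⇒≉0 {d} (divides q dq≈a) a≉0) (≋-trans (quot-correct {d = d} a≉0 (divides q dq≈a)) (≋-sym dq≈a))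

Coprime : Poly → Poly → Set
Coprime d e = ∀ {c} → c ∣ₚ d → c ∣ₚ e → c ≋ 1P

coprime?-sound : ∀ {d e} → ¬ d ≋ 0P → ¬ e ≋ 0P → T (coprime? d e) → Coprime d e
coprime?-sound {d} {e} d≉0 e≉0 h {c} c∣d c∣e
  with All.lookup (all⁺ _ (divisors d) h) (∈-divisors⁺ d≉0 (norm-idem c) (∣ₚ-respˡ (≋-sym (norm-≋ c)) c∣d))
     | divides?-complete e≉0 (∣ₚ-respˡ (≋-sym (norm-≋ c)) c∣e)
... | c-test | norm-c∣e with divides? (norm c) e
... | false = ⊥-elim norm-c∣e
... | true = ≋-trans (≋-sym (norm-≋ c)) (==⇒≋ c-test)

coprime?-complete : ∀ {d e} → ¬ e ≋ 0P → Coprime d e → T (coprime? d e)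
coprime?-complete {d} {e} e≉0 coprime = all⁻ _ (All.tabulate test)
  where
  test : ∀ {c} → c ∈ divisors d → T (not (divides? c e) ∨ (c == 1P))
  test {c} c∈ with divides? c e in eq
  ... | false = _
  ... | true = ≋⇒== (coprime (proj₂ (∈-divisors⁻ d c∈)) (divides?-sound c e (≡.subst T (≡.sym eq) _)))

Unitary : Poly → Poly → Set
Unitary d a = d ∣ₚ a × (∀ {q} → d *P q ≋ a → Coprime d q)

∈-unitaryDivisors⁻ : ∀ {a d} → ¬ a ≋ 0P → d ∈ unitaryDivisors a → Normal d × Unitary d a
∈-unitaryDivisors⁻ {a} {d} a≉0 d∈ with ∈-filter⁻ (λ d → T? (coprime? d (quot a d))) {xs = divisors a} d∈
... | d∈′ , h with ∈-divisors⁻ a d∈′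
... | d-normal , d∣a = d-normal , d∣a , λ {q} dq≈a c∣d c∣q →
  coprime?-sound (∣ₚ⇒≉0 d∣a a≉0) (quot-≉0 a≉0 d∣a) h c∣d
    (∣ₚ-respʳ (≋-sym (quot-unique {d = d} a≉0 dq≈a)) c∣q)

∈-unitaryDivisors⁺ : ∀ {a d} → ¬ a ≋ 0P → Normal d → Unitary d a → d ∈ unitaryDivisors a
∈-unitaryDivisors⁺ {a} {d} a≉0 d-normal (d∣a , coprime) =
  ∈-filter⁺ (λ d → T? (coprime? d (quot a d))) (∈-divisors⁺ a≉0 d-normal d∣a)
    (coprime?-complete (quot-≉0 a≉0 d∣a) (coprime (quot-correct a≉0 d∣a)))

unitaryDivisors-unique : ∀ a → Unique (unitaryDivisors a)
unitaryDivisors-unique a = Unique.filter⁺ (λ d → T? (coprime? d (quot a d))) (divisors-unique a)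

sumP-↭ : ∀ {L K} → L ↭ K → sumP L ≋ sumP K
sumP-↭ ↭-refl = ≋-refl
sumP-↭ (prep x L↭K) = +-cong ≋-refl (sumP-↭ L↭K)
sumP-↭ {x ∷ y ∷ xs} (swap x y L↭K) =
  ≋-trans (+-swapˡ x y (sumP xs)) (+-cong (≋-refl {y}) (+-cong (≋-refl {x}) (sumP-↭ L↭K)))
sumP-↭ (↭-trans L↭M M↭K) = ≋-trans (sumP-↭ L↭M) (sumP-↭ M↭K)

sum-over-same-elements : ∀ (h : Poly → Poly) {L K} → Unique L → Unique K →
  (∀ {x} → x ∈ L → x ∈ K) → (∀ {x} → x ∈ K → x ∈ L) → sumP (map h L) ≋ sumP (map h K)
sum-over-same-elements h uL uK L⊆K K⊆L =
  sumP-↭ (↭.map⁺ h (∼bag⇒↭ (unique∧set⇒bag uL uK (mk⇔ L⊆K K⊆L))))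

sumP-++ : ∀ L K → sumP (L ++ K) ≋ sumP L +P sumP K
sumP-++ [] K = ≋-refl
sumP-++ (x ∷ L) K = ≋-trans (+-cong ≋-refl (sumP-++ L K)) (≋-sym (+-assoc x (sumP L) (sumP K)))

sum-cong : ∀ {f g : Poly → Poly} L → (∀ {x} → x ∈ L → f x ≋ g x) → sumP (map f L) ≋ sumP (map g L)
sum-cong [] h = ≋-refl
sum-cong (x ∷ L) h = +-cong (h (here ≡.refl)) (sum-cong L (λ x∈ → h (there x∈)))

sum-*ˡ : ∀ c (f : Poly → Poly) L → sumP (map (λ x → c *P f x) L) ≋ c *P sumP (map f L)
sum-*ˡ c f [] = ≋-sym (*-zeroʳ c)
sum-*ˡ c f (x ∷ L) = ≋-trans (+-cong ≋-refl (sum-*ˡ c f L)) (≋-sym (*-distribˡ c (f x) (sumP (map f L))))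

sum-filter : ∀ (b : Poly → Bool) (f : Poly → Poly) L →
  sumP (map f L) ≋ sumP (map f (filterᵇ b L)) +P sumP (map f (filterᵇ (not ∘ b) L))
sum-filter b f [] = ≋-refl
sum-filter b f (x ∷ L) with b x
... | true = ≋-trans (+-cong ≋-refl (sum-filter b f L)) (≋-sym (+-assoc (f x) _ _))
... | false = ≋-trans (+-cong ≋-refl (sum-filter b f L))
                     (+-swapˡ (f x) (sumP (map f (filterᵇ b L))) (sumP (map f (filterᵇ (not ∘ b) L))))

infixr 8 _^P_
_^P_ : Poly → ℕ → Poly
p ^P zero = 1P
p ^P suc i = p *P p ^P i

^P-+ : ∀ p i j → p ^P (i + j) ≋ p ^P i *P p ^P j
^P-+ p zero j = ≋-sym (*-identityˡ (p ^P j))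
^P-+ p (suc i) j = ≋-trans (*-congʳ p (^P-+ p i j)) (≋-sym (*-assoc p (p ^P i) (p ^P j)))

^P-≉0 : ∀ {p} i → ¬ p ≋ 0P → ¬ p ^P i ≋ 0P
^P-≉0 zero p≉0 ()
^P-≉0 (suc i) p≉0 = *-≉0 p≉0 (^P-≉0 i p≉0)

len≥2⇒≉0 : ∀ {p} → 2 ≤ len p → ¬ p ≋ 0P
len≥2⇒≉0 2≤p p≈0 = ℕₚ.<⇒≱ 2≤p (ℕₚ.≤-trans (ℕₚ.≤-reflexive (≋⇒len≡ p≈0)) z≤n)

irreducible⇒≉0 : ∀ {p} → Irreducible p → ¬ p ≋ 0P
irreducible⇒≉0 (2≤p , _) = len≥2⇒≉0 2≤p

irreducible⇒≉1 : ∀ {p} → Irreducible p → ¬ p ≋ 1P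
irreducible⇒≉1 (2≤p , _) p≈1 = ℕₚ.<⇒≢ 2≤p (≡.sym (≋⇒len≡ p≈1))

_∣?_ : ∀ p → ¬ p ≋ 0P → ∀ D → Dec (p ∣ₚ D)
(p ∣? p≉0) D with divMod D p p≉0
... | result q r D≈pq+r r<p with r ≋? 0P
... | yes r≈0 = yes (divides q (≋-sym (≋-trans D≈pq+r (≋-trans (+-cong ≋-refl r≈0) (+-identityʳ (p *P q))))))
... | no r≉0 = no λ p∣D →
  ℕₚ.<⇒≱ r<p (∣ₚ⇒len≤ (∣ₚ-respʳ (≋-sym r≈D+pq) (∣p∣q⇒∣p+q p∣D (p∣p*q p q))) r≉0)
  where
  open PolySolver
  r≈D+pq : r ≋ D +P p *P q
  r≈D+pq = ≋-trans (solve 2 (λ x r → r := (x :+ r) :+ x) ≋-refl (p *P q) r) (+-cong (≋-sym D≈pq+r) ≋-refl)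

module _ {p} (p-irr : Irreducible p) where

  private
    p≉0 : ¬ p ≋ 0P
    p≉0 = irreducible⇒≉0 p-irr

  ∣p*⇒∣ : ∀ {x Y} → ¬ p ∣ₚ x → x ∣ₚ p *P Y → x ∣ₚ Y
  ∣p*⇒∣ {x} {Y} p∤x (divides k xk≈pY) with euclidsLemma x k p-irr (∣ₚ-respʳ (≋-sym xk≈pY) (p∣p*q p Y)) p∤x
  ... | divides k′ pk′≈k = divides k′ (*-cancelˡ p p≉0 (begin
    p *P (x *P k′)   ≈⟨ *-swapˡ p x k′ ⟩
    x *P (p *P k′)   ≈⟨ *-congʳ x pk′≈k ⟩
    x *P k           ≈⟨ xk≈pY ⟩
    p *P Y           ∎))
    where open ≋-Reasoning

  ∣p^*⇒∣ : ∀ {x} k {Y} → ¬ p ∣ₚ x → x ∣ₚ p ^P k *P Y → x ∣ₚ Y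
  ∣p^*⇒∣ zero p∤x x∣Y = ∣ₚ-respʳ (*-identityˡ _) x∣Y
  ∣p^*⇒∣ (suc k) {Y} p∤x x∣ = ∣p^*⇒∣ k p∤x (∣p*⇒∣ p∤x (∣ₚ-respʳ (*-assoc p (p ^P k) Y) x∣))

  record PowerSplit (C D : Poly) (a : ℕ) : Set where
    constructor power-split
    field
      i k : ℕ
      i+k≡a : i + k ≡ a
      F : Poly
      D≈p^i*F : D ≋ p ^P i *P F
      F∣C : F ∣ₚ C

  split-divisor : ∀ {C D} a → D ∣ₚ p ^P a *P C → PowerSplit C D a
  split-divisor {C} {D} zero D∣C =
    power-split 0 0 ≡.refl D (≋-sym (*-identityˡ D)) (∣ₚ-respʳ (*-identityˡ C) D∣C)
  split-divisor {C} {D} (suc a) D∣ with (p ∣? p≉0) D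
  ... | no p∤D =
    let power-split i k i+k≡a F D≈ F∣C = split-divisor a (∣p*⇒∣ p∤D (∣ₚ-respʳ (*-assoc p (p ^P a) C) D∣))
    in power-split i (suc k) (≡.trans (ℕₚ.+-suc i k) (cong suc i+k≡a)) F D≈ F∣C
  ... | yes (divides D′ pD′≈D) =
    let power-split i k i+k≡a F D′≈ F∣C = split-divisor a D′∣
    in power-split (suc i) k (cong suc i+k≡a) F
         (≋-trans (≋-sym pD′≈D) (≋-trans (*-congʳ p D′≈) (≋-sym (*-assoc p (p ^P i) F)))) F∣C
    where
    D′∣ : D′ ∣ₚ p ^P a *P C
    D′∣ = let divides q Dq≈ = D∣ in divides q (*-cancelˡ p p≉0 (begin
      p *P (D′ *P q)   ≈⟨ *-assoc p D′ q ⟨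
      (p *P D′) *P q   ≈⟨ *-congˡ q pD′≈D ⟩
      D *P q           ≈⟨ Dq≈ ⟩
      p ^P suc a *P C  ≈⟨ *-assoc p (p ^P a) C ⟩
      p *P (p ^P a *P C) ∎))
      where open ≋-Reasoning

  p^*-unique : ∀ i j {E E′} → ¬ p ∣ₚ E → ¬ p ∣ₚ E′ → p ^P i *P E ≋ p ^P j *P E′ → i ≡ j × E ≋ E′
  p^*-unique zero zero {E} {E′} _ _ e = ≡.refl , ≋-trans (≋-sym (*-identityˡ E)) (≋-trans e (*-identityˡ E′))
  p^*-unique zero (suc j) {E} {E′} p∤E _ e =
    ⊥-elim (p∤E (divides (p ^P j *P E′)
      (≋-trans (≋-sym (*-assoc p (p ^P j) E′)) (≋-trans (≋-sym e) (*-identityˡ E)))))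
  p^*-unique (suc i) zero {E} {E′} _ p∤E′ e =
    ⊥-elim (p∤E′ (divides (p ^P i *P E)
      (≋-trans (≋-sym (*-assoc p (p ^P i) E)) (≋-trans e (*-identityˡ E′)))))
  p^*-unique (suc i) (suc j) {E} {E′} p∤E p∤E′ e
    with p^*-unique i j p∤E p∤E′
           (*-cancelˡ p p≉0 (≋-trans (≋-sym (*-assoc p (p ^P i) E)) (≋-trans e (*-assoc p (p ^P j) E′))))
  ... | ≡.refl , E≈E′ = ≡.refl , E≈E′

-- Divisors of p^a C and unitary divisors of p^i E, for p ∤ C, E

Coprime-respˡ : ∀ {d d′ e} → d ≋ d′ → Coprime d e → Coprime d′ e
Coprime-respˡ d≈d′ coprime c∣d′ = coprime (∣ₚ-respʳ (≋-sym d≈d′) c∣d′)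

Unitary-respˡ : ∀ {d d′ a} → d ≋ d′ → Unitary d a → Unitary d′ a
Unitary-respˡ {d′ = d′} d≈d′ (d∣a , coprime) =
  ∣ₚ-respˡ d≈d′ d∣a , λ {q} d′q≈a → Coprime-respˡ d≈d′ (coprime (≋-trans (*-congˡ q d≈d′) d′q≈a))

Unitary-respʳ : ∀ {d a a′} → a ≋ a′ → Unitary d a → Unitary d a′
Unitary-respʳ a≈a′ (d∣a , coprime) = ∣ₚ-respʳ a≈a′ d∣a , λ dq≈a′ → coprime (≋-trans dq≈a′ (≋-sym a≈a′))

scaled : Poly → List Poly → List Poly
scaled c = map (λ F → norm (c *P F))

scaled-unique : ∀ {c L} → ¬ c ≋ 0P → All Normal L → Unique L → Unique (scaled c L)
scaled-unique {c} c≉0 normal = map-unique _ λ x∈ y∈ e →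
  ≋⇒≡ (All.lookup normal x∈) (All.lookup normal y∈) (*-cancelˡ c c≉0 (mk≋ e))

sum-scaled : ∀ c L → sumP (scaled c L) ≋ c *P sumP L
sum-scaled c L = ≋-trans (sum-cong L (λ {F} _ → norm-≋ (c *P F)))
                   (≋-trans (sum-*ˡ c (λ F → F) L) (*-congʳ c (≡⇒≋ (cong sumP (map-id L)))))

p∣p^suc* : ∀ {p} k F → p ∣ₚ p ^P suc k *P F
p∣p^suc* {p} k F = ∣ₚ-respʳ (≋-sym (*-assoc p (p ^P k) F)) (p∣p*q p (p ^P k *P F))

module UnitaryDivisorsOfPower {p} (p-irr : Irreducible p) {E} (E≉0 : ¬ E ≋ 0P) (p∤E : ¬ p ∣ₚ E) (i : ℕ) where

  P : Poly
  P = p ^P suc i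

  private
    P≉0 : ¬ P ≋ 0P
    P≉0 = ^P-≉0 (suc i) (irreducible⇒≉0 {p} p-irr)

    PE≉0 : ¬ P *P E ≋ 0P
    PE≉0 = *-≉0 P≉0 E≉0

    p∤divisor : ∀ {c} → c ∣ₚ E → ¬ p ∣ₚ c
    p∤divisor c∣E p∣c = p∤E (∣ₚ-trans p∣c c∣E)

    p∣P* : ∀ F → p ∣ₚ P *P F
    p∣P* = p∣p^suc* i

  unitary⇒unitary-in-P* : ∀ {F} → Unitary F E → Unitary F (P *P E)
  unitary⇒unitary-in-P* {F} (divides G FG≈E , coprime) = ∣p⇒∣q*p P (divides G FG≈E) , λ {q} Fq≈PE c∣F c∣q →
    coprime FG≈E c∣F (∣p^*⇒∣ p-irr (suc i) (p∤divisor (∣ₚ-trans c∣F (divides G FG≈E)))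
      (∣ₚ-respʳ (q≈PG Fq≈PE) c∣q))
    where
    q≈PG : ∀ {q} → F *P q ≋ P *P E → q ≋ P *P G
    q≈PG {q} Fq≈PE = *-cancelˡ F (∣ₚ⇒≉0 (divides G FG≈E) E≉0) (begin
      F *P q          ≈⟨ Fq≈PE ⟩
      P *P E          ≈⟨ *-congʳ P FG≈E ⟨
      P *P (F *P G)   ≈⟨ *-swapˡ P F G ⟩
      F *P (P *P G)   ∎)
      where open ≋-Reasoning

  unitary⇒P*-unitary : ∀ {F} → Unitary F E → Unitary (P *P F) (P *P E)
  unitary⇒P*-unitary {F} (divides G FG≈E , coprime) =
    divides G (≋-trans (*-assoc P F G) (*-congʳ P FG≈E)) , λ {q} PFq≈PE c∣PF c∣q →
      let Fq≈E = *-cancelˡ P P≉0 (≋-trans (≋-sym (*-assoc P F q)) PFq≈PE)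
          p∤c = p∤divisor (∣ₚ-trans c∣q (divides F (≋-trans (*-comm q F) Fq≈E)))
      in coprime Fq≈E (∣p^*⇒∣ p-irr (suc i) p∤c c∣PF) c∣q

  unitary-in-P*⇒ : ∀ {x} → Unitary x (P *P E) → Unitary x E ⊎ Σ Poly λ F → x ≋ P *P F × Unitary F E
  unitary-in-P*⇒ {x} (x∣PE , coprime) with split-divisor {p} p-irr (suc i) x∣PE
  ... | power-split zero k _ F x≈F F∣E = inj₁ (Unitary-respˡ (≋-sym x≈1F) (F∣E , λ {q} Fq≈E c∣F c∣q →
        coprime (cofactor Fq≈E) (∣ₚ-respʳ (≋-sym x≈1F) c∣F) (∣p⇒∣q*p P c∣q)))
    where
    x≈1F : x ≋ F
    x≈1F = ≋-trans x≈F (*-identityˡ F)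
    cofactor : ∀ {q} → F *P q ≋ E → x *P (P *P q) ≋ P *P E
    cofactor {q} Fq≈E = ≋-trans (*-swapˡ x P q) (*-congʳ P (≋-trans (*-congˡ q x≈1F) Fq≈E))
  ... | power-split (suc j) zero j+0≡I F x≈ F∣E = inj₂ (F , x≈PF , F∣E , λ {q} Fq≈E c∣F c∣q →
        coprime (≋-trans (*-congˡ q x≈PF) (≋-trans (*-assoc P F q) (*-congʳ P Fq≈E)))
                (∣ₚ-respʳ (≋-sym x≈PF) (∣p⇒∣q*p P c∣F)) c∣q)
    where
    x≈PF : x ≋ P *P F
    x≈PF = ≋-trans x≈ (*-congˡ F (≡⇒≋ (cong (p ^P_) (≡.trans (≡.sym (ℕₚ.+-identityʳ (suc j))) j+0≡I))))
  ... | power-split (suc j) (suc k) j+k≡I F x≈ (divides G FG≈E) =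
        ⊥-elim (irreducible⇒≉1 {p} p-irr (coprime x*cofactor p∣x (p∣p^suc* {p} k G)))
    where
    p∣x : p ∣ₚ x
    p∣x = ∣ₚ-respʳ (≋-sym x≈) (p∣p^suc* {p} j F)
    x*cofactor : x *P (p ^P suc k *P G) ≋ P *P E
    x*cofactor = begin
      x *P (p ^P suc k *P G)                     ≈⟨ *-congˡ _ x≈ ⟩
      (p ^P suc j *P F) *P (p ^P suc k *P G)     ≈⟨ *-interchange (p ^P suc j) F (p ^P suc k) G ⟩
      (p ^P suc j *P p ^P suc k) *P (F *P G)     ≈⟨ *-cong (≋-sym (^P-+ p (suc j) (suc k))) FG≈E ⟩
      p ^P (suc j + suc k) *P E                  ≡⟨ cong (λ n → p ^P n *P E) j+k≡I ⟩
      P *P E                                     ∎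
      where open ≋-Reasoning

  private
    U : List Poly
    U = unitaryDivisors E
    U-normal : All Normal U
    U-normal = All.tabulate (λ F∈ → proj₁ (∈-unitaryDivisors⁻ E≉0 F∈))

  unitaryDivisors-P* : List Poly
  unitaryDivisors-P* = U ++ scaled P U

  unitaryDivisors-P*-unique : Unique unitaryDivisors-P*
  unitaryDivisors-P*-unique =
    Unique.++⁺ (unitaryDivisors-unique E) (scaled-unique P≉0 U-normal (unitaryDivisors-unique E)) disjoint
    where
    disjoint : ∀ {x} → x ∈ U × x ∈ scaled P U → ⊥
    disjoint (x∈U , x∈PU) with ∈-map⁻ _ x∈PU
    ... | F , _ , ≡.refl =
      p∤divisor (proj₁ (proj₂ (∈-unitaryDivisors⁻ E≉0 x∈U))) (∣ₚ-respʳ (≋-sym (norm-≋ (P *P F))) (p∣P* F))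

  module _ {B} (B≈PE : B ≋ P *P E) where

    private
      B≉0 : ¬ B ≋ 0P
      B≉0 B≈0 = PE≉0 (≋-trans (≋-sym B≈PE) B≈0)

    unitaryDivisors-P*⊆ : ∀ {x} → x ∈ unitaryDivisors-P* → x ∈ unitaryDivisors B
    unitaryDivisors-P*⊆ x∈ with ∈-++⁻ U x∈
    ... | inj₁ x∈U = let (x-normal , x-unitary) = ∈-unitaryDivisors⁻ E≉0 x∈U in
      ∈-unitaryDivisors⁺ B≉0 x-normal (Unitary-respʳ (≋-sym B≈PE) (unitary⇒unitary-in-P* x-unitary))
    ... | inj₂ x∈PU with ∈-map⁻ _ x∈PU
    ... | F , F∈U , ≡.refl = ∈-unitaryDivisors⁺ B≉0 (norm-idem (P *P F))
      (Unitary-respʳ (≋-sym B≈PE) (Unitary-respˡ (≋-sym (norm-≋ (P *P F)))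
        (unitary⇒P*-unitary (proj₂ (∈-unitaryDivisors⁻ E≉0 F∈U)))))

    ⊆unitaryDivisors-P* : ∀ {x} → x ∈ unitaryDivisors B → x ∈ unitaryDivisors-P*
    ⊆unitaryDivisors-P* {x} x∈ =
      from-cases (unitary-in-P*⇒ (Unitary-respʳ B≈PE (proj₂ (∈-unitaryDivisors⁻ B≉0 x∈))))
      where
      x-normal : Normal x
      x-normal = proj₁ (∈-unitaryDivisors⁻ B≉0 x∈)
      from-cases : Unitary x E ⊎ Σ Poly (λ F → x ≋ P *P F × Unitary F E) → x ∈ unitaryDivisors-P*
      from-cases (inj₁ x-unitary-in-E) = ∈-++⁺ˡ (∈-unitaryDivisors⁺ E≉0 x-normal x-unitary-in-E)
      from-cases (inj₂ (F , x≈PF , F-unitary)) =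
        ∈-++⁺ʳ U (≡.subst (_∈ scaled P U) (≡.sym x≡) (∈-map⁺ _ normF∈U))
        where
        normF∈U : norm F ∈ U
        normF∈U = ∈-unitaryDivisors⁺ E≉0 (norm-idem F) (Unitary-respˡ (≋-sym (norm-≋ F)) F-unitary)
        x≡ : x ≡ norm (P *P norm F)
        x≡ = ≋⇒≡ x-normal (norm-idem (P *P norm F))
               (≋-trans x≈PF (≋-trans (*-congʳ P (≋-sym (norm-≋ F))) (≋-sym (norm-≋ (P *P norm F)))))

    σ*-P* : σ* B ≋ (1P +P P) *P σ* E
    σ*-P* = begin
      σ* B                           ≡⟨ cong sumP (map-id (unitaryDivisors B)) ⟨
      sumP (map (λ x → x) (unitaryDivisors B))
        ≈⟨ sum-over-same-elements (λ x → x) (unitaryDivisors-unique B) unitaryDivisors-P*-unique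
             ⊆unitaryDivisors-P* unitaryDivisors-P*⊆ ⟩
      sumP (map (λ x → x) unitaryDivisors-P*) ≡⟨ cong sumP (map-id unitaryDivisors-P*) ⟩
      sumP (U ++ scaled P U)         ≈⟨ sumP-++ U (scaled P U) ⟩
      σ* E +P sumP (scaled P U)      ≈⟨ +-cong (≋-sym (*-identityˡ (σ* E))) (sum-scaled P U) ⟩
      1P *P σ* E +P P *P σ* E        ≈⟨ *-distribʳ (σ* E) 1P P ⟨
      (1P +P P) *P σ* E              ∎
      where open ≋-Reasoning

sum≤ : ℕ → (ℕ → Poly) → Poly
sum≤ zero c = c 0
sum≤ (suc a) c = sum≤ a c +P c (suc a)

sum≤-cong : ∀ a {c d : ℕ → Poly} → (∀ {i} → i ≤ a → c i ≋ d i) → sum≤ a c ≋ sum≤ a d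
sum≤-cong zero h = h z≤n
sum≤-cong (suc a) h = +-cong (sum≤-cong a (λ i≤a → h (ℕₚ.m≤n⇒m≤1+n i≤a))) (h ℕₚ.≤-refl)

sum≤-*ʳ : ∀ a (c : ℕ → Poly) X → sum≤ a (λ i → c i *P X) ≋ sum≤ a c *P X
sum≤-*ʳ zero c X = ≋-refl
sum≤-*ʳ (suc a) c X = ≋-trans (+-cong (sum≤-*ʳ a c X) ≋-refl) (≋-sym (*-distribʳ X (sum≤ a c) (c (suc a))))

unitaryDivisors-⊆ : ∀ {A B} → ¬ A ≋ 0P → ¬ B ≋ 0P → A ≋ B →
                    ∀ {x} → x ∈ unitaryDivisors A → x ∈ unitaryDivisors B
unitaryDivisors-⊆ A≉0 B≉0 A≈B x∈ =
  let (x-normal , x-unitary) = ∈-unitaryDivisors⁻ A≉0 x∈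
  in ∈-unitaryDivisors⁺ B≉0 x-normal (Unitary-respʳ A≈B x-unitary)

σ*-cong : ∀ {A B} → ¬ A ≋ 0P → A ≋ B → σ* A ≋ σ* B
σ*-cong {A} {B} A≉0 A≈B = begin
  σ* A                                        ≡⟨ cong sumP (map-id (unitaryDivisors A)) ⟨
  sumP (map (λ x → x) (unitaryDivisors A))
    ≈⟨ sum-over-same-elements (λ x → x) (unitaryDivisors-unique A) (unitaryDivisors-unique B)
         (unitaryDivisors-⊆ A≉0 B≉0 A≈B) (unitaryDivisors-⊆ B≉0 A≉0 (≋-sym A≈B)) ⟩
  sumP (map (λ x → x) (unitaryDivisors B))    ≡⟨ cong sumP (map-id (unitaryDivisors B)) ⟩
  σ* B                                        ∎
  where
  open ≋-Reasoning
  B≉0 : ¬ B ≋ 0P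
  B≉0 B≈0 = A≉0 (≋-trans A≈B B≈0)

σ*⋆id : Poly → Poly
σ*⋆id A = sumP (map (λ D → σ* D *P quot A D) (divisors A))

σ*-power : Poly → ℕ → Poly
σ*-power p zero = 1P
σ*-power p (suc i) = 1P +P p ^P suc i

σ-power : Poly → ℕ → Poly
σ-power p a = sum≤ a (p ^P_)

σ*⋆id-power : Poly → ℕ → Poly
σ*⋆id-power p a = sum≤ a (λ i → σ*-power p i *P p ^P (a ∸ i))

module DivisorsOfPower {p} (p-irr : Irreducible p) {C} (C≉0 : ¬ C ≋ 0P) (p∤C : ¬ p ∣ₚ C) where

  private
    p≉0 : ¬ p ≋ 0P
    p≉0 = irreducible⇒≉0 {p} p-irr

    divisors-normal : All Normal (divisors C)
    divisors-normal = All.tabulate (λ E∈ → proj₁ (∈-divisors⁻ C E∈))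

    p∤divisor : ∀ {E} → E ∈ divisors C → ¬ p ∣ₚ E
    p∤divisor E∈ p∣E = p∤C (∣ₚ-trans p∣E (proj₂ (∈-divisors⁻ C E∈)))

  layer : ℕ → List Poly
  layer i = scaled (p ^P i) (divisors C)

  layers : ℕ → List Poly
  layers zero = layer 0
  layers (suc a) = layers a ++ layer (suc a)

  ∈-layers⁻ : ∀ a {x} → x ∈ layers a → Σ ℕ λ i → i ≤ a × x ∈ layer i
  ∈-layers⁻ zero x∈ = 0 , z≤n , x∈
  ∈-layers⁻ (suc a) x∈ with ∈-++⁻ (layers a) x∈
  ... | inj₁ x∈′ = let (i , i≤a , x∈i) = ∈-layers⁻ a x∈′ in i , ℕₚ.m≤n⇒m≤1+n i≤a , x∈i
  ... | inj₂ x∈′ = suc a , ℕₚ.≤-refl , x∈′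

  ∈-layers⁺ : ∀ {a i x} → i ≤ a → x ∈ layer i → x ∈ layers a
  ∈-layers⁺ {zero} z≤n x∈ = x∈
  ∈-layers⁺ {suc a} {i} i≤1+a x∈ with i ℕ.≟ suc a
  ... | yes ≡.refl = ∈-++⁺ʳ (layers a) x∈
  ... | no i≢1+a = ∈-++⁺ˡ (∈-layers⁺ (ℕₚ.≤-pred (ℕₚ.≤∧≢⇒< i≤1+a i≢1+a)) x∈)

  layer-injective : ∀ {i j x} → x ∈ layer i → x ∈ layer j → i ≡ j
  layer-injective {i} {j} x∈i x∈j with ∈-map⁻ _ x∈i | ∈-map⁻ _ x∈j
  ... | E , E∈ , e | E′ , E′∈ , e′ =
    proj₁ (p^*-unique {p} p-irr i j (p∤divisor E∈) (p∤divisor E′∈) (mk≋ (≡.trans (≡.sym e) e′)))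

  layers-unique : ∀ a → Unique (layers a)
  layers-unique zero = scaled-unique (^P-≉0 0 p≉0) divisors-normal (divisors-unique C)
  layers-unique (suc a) =
    Unique.++⁺ (layers-unique a) (scaled-unique (^P-≉0 (suc a) p≉0) divisors-normal (divisors-unique C)) disjoint
    where
    disjoint : ∀ {x} → x ∈ layers a × x ∈ layer (suc a) → ⊥
    disjoint (x∈ , x∈′) with ∈-layers⁻ a x∈
    ... | i , i≤a , x∈i with layer-injective {i} {suc a} x∈i x∈′
    ... | ≡.refl = ℕₚ.<-irrefl ≡.refl i≤a

  sum-layers : ∀ (h : Poly → Poly) a → sumP (map h (layers a)) ≋ sum≤ a (λ i → sumP (map h (layer i)))
  sum-layers h zero = ≋-refl
  sum-layers h (suc a) = ≋-trans (≡⇒≋ (cong sumP (map-++ h (layers a) (layer (suc a)))))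
    (≋-trans (sumP-++ (map h (layers a)) (map h (layer (suc a)))) (+-cong (sum-layers h a) ≋-refl))


  σ*-layer : ∀ i {E} → E ∈ divisors C → σ* (norm (p ^P i *P E)) ≋ σ*-power p i *P σ* E
  σ*-layer zero {E} E∈ =
    ≋-trans (σ*-cong (λ z → E≉0 (≋-trans (≋-sym normE≈E) z)) normE≈E) (≋-sym (*-identityˡ (σ* E)))
    where
    E≉0 : ¬ E ≋ 0P
    E≉0 = ∣ₚ⇒≉0 (proj₂ (∈-divisors⁻ C E∈)) C≉0
    normE≈E : norm (1P *P E) ≋ E
    normE≈E = ≋-trans (norm-≋ (1P *P E)) (*-identityˡ E)
  σ*-layer (suc j) {E} E∈ = UnitaryDivisorsOfPower.σ*-P* {p} p-irr (∣ₚ⇒≉0 (proj₂ (∈-divisors⁻ C E∈)) C≉0)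
    (p∤divisor E∈) j (norm-≋ (p ^P suc j *P E))

  module _ {a A} (A≈p^a*C : A ≋ p ^P a *P C) where

    private
      A≉0 : ¬ A ≋ 0P
      A≉0 A≈0 = *-≉0 (^P-≉0 a p≉0) C≉0 (≋-trans (≋-sym A≈p^a*C) A≈0)

    layer-complement : ∀ {i E Q} → i ≤ a → E *P Q ≋ C → (p ^P i *P E) *P (p ^P (a ∸ i) *P Q) ≋ A
    layer-complement {i} {E} {Q} i≤a EQ≈C = begin
      (p ^P i *P E) *P (p ^P (a ∸ i) *P Q)   ≈⟨ *-interchange (p ^P i) E (p ^P (a ∸ i)) Q ⟩
      (p ^P i *P p ^P (a ∸ i)) *P (E *P Q)   ≈⟨ *-cong (≋-sym (^P-+ p i (a ∸ i))) EQ≈C ⟩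
      p ^P (i + (a ∸ i)) *P C                ≡⟨ cong (λ n → p ^P n *P C) (ℕₚ.m+[n∸m]≡n i≤a) ⟩
      p ^P a *P C                            ≈⟨ A≈p^a*C ⟨
      A                                      ∎
      where open ≋-Reasoning

    divisors⊆layers : ∀ {x} → x ∈ divisors A → x ∈ layers a
    divisors⊆layers {x} x∈ with ∈-divisors⁻ A x∈
    ... | x-normal , x∣A with split-divisor {p} p-irr a (∣ₚ-respʳ A≈p^a*C x∣A)
    ... | power-split i k i+k≡a F x≈p^iF F∣C =
      ∈-layers⁺ (≡.subst (i ≤_) i+k≡a (ℕₚ.m≤m+n i k)) (≡.subst (_∈ layer i) (≡.sym x≡) (∈-map⁺ _ normF∈))
      where
      normF∈ : norm F ∈ divisors C
      normF∈ = ∈-divisors⁺ C≉0 (norm-idem F) (∣ₚ-respˡ (≋-sym (norm-≋ F)) F∣C)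
      x≡ : x ≡ norm (p ^P i *P norm F)
      x≡ = ≋⇒≡ x-normal (norm-idem (p ^P i *P norm F))
             (≋-trans x≈p^iF (≋-trans (*-congʳ (p ^P i) (≋-sym (norm-≋ F))) (≋-sym (norm-≋ (p ^P i *P norm F)))))

    layers⊆divisors : ∀ {x} → x ∈ layers a → x ∈ divisors A
    layers⊆divisors x∈ with ∈-layers⁻ a x∈
    ... | i , i≤a , x∈i with ∈-map⁻ (λ E → norm (p ^P i *P E)) x∈i
    ... | E , E∈ , ≡.refl with ∈-divisors⁻ C E∈
    ... | _ , divides G EG≈C = ∈-divisors⁺ A≉0 (norm-idem (p ^P i *P E))
      (divides (p ^P (a ∸ i) *P G)
        (≋-trans (*-congˡ (p ^P (a ∸ i) *P G) (norm-≋ (p ^P i *P E))) (layer-complement i≤a EG≈C)))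

    sum-divisors : ∀ (h : Poly → Poly) → sumP (map h (divisors A)) ≋ sum≤ a (λ i → sumP (map h (layer i)))
    sum-divisors h = ≋-trans
      (sum-over-same-elements h (divisors-unique A) (layers-unique a) divisors⊆layers layers⊆divisors)
      (sum-layers h a)

    σ-p^a* : σ A ≋ σ-power p a *P σ C
    σ-p^a* = begin
      σ A                                         ≡⟨ cong sumP (map-id (divisors A)) ⟨
      sumP (map (λ x → x) (divisors A))           ≈⟨ sum-divisors (λ x → x) ⟩
      sum≤ a (λ i → sumP (map (λ x → x) (layer i)))  ≈⟨ sum≤-cong a layer-sum ⟩
      sum≤ a (λ i → p ^P i *P σ C)                ≈⟨ sum≤-*ʳ a (p ^P_) (σ C) ⟩
      σ-power p a *P σ C                          ∎
      where
      open ≋-Reasoning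
      layer-sum : ∀ {i} → i ≤ a → sumP (map (λ x → x) (layer i)) ≋ p ^P i *P σ C
      layer-sum {i} _ = ≋-trans (≡⇒≋ (cong sumP (map-id (layer i)))) (sum-scaled (p ^P i) (divisors C))

    σ*⋆id-p^a* : σ*⋆id A ≋ σ*⋆id-power p a *P σ*⋆id C
    σ*⋆id-p^a* = begin
      σ*⋆id A                                                     ≈⟨ sum-divisors h ⟩
      sum≤ a (λ i → sumP (map h (layer i)))                       ≈⟨ sum≤-cong a layer-sum ⟩
      sum≤ a (λ i → (σ*-power p i *P p ^P (a ∸ i)) *P σ*⋆id C)    ≈⟨ sum≤-*ʳ a _ (σ*⋆id C) ⟩
      σ*⋆id-power p a *P σ*⋆id C                                  ∎
      where
      open ≋-Reasoning
      h : Poly → Poly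
      h D = σ* D *P quot A D
      term : ∀ {i E} → i ≤ a → E ∈ divisors C →
             h (norm (p ^P i *P E)) ≋ (σ*-power p i *P p ^P (a ∸ i)) *P (σ* E *P quot C E)
      term {i} {E} i≤a E∈ =
        ≋-trans (*-cong (σ*-layer i E∈) quot≈) (*-interchange (σ*-power p i) (σ* E) (p ^P (a ∸ i)) (quot C E))
        where
        E∣C : E ∣ₚ C
        E∣C = proj₂ (∈-divisors⁻ C E∈)
        quot≈ : quot A (norm (p ^P i *P E)) ≋ p ^P (a ∸ i) *P quot C E
        quot≈ = quot-unique {d = norm (p ^P i *P E)} A≉0
          (≋-trans (*-congˡ (p ^P (a ∸ i) *P quot C E) (norm-≋ (p ^P i *P E)))
                   (layer-complement i≤a (quot-correct C≉0 E∣C)))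
      layer-sum : ∀ {i} → i ≤ a → sumP (map h (layer i)) ≋ (σ*-power p i *P p ^P (a ∸ i)) *P σ*⋆id C
      layer-sum {i} i≤a = begin
        sumP (map h (layer i))
          ≡⟨ cong sumP (map-∘ (divisors C)) ⟨
        sumP (map (λ E → h (norm (p ^P i *P E))) (divisors C))
          ≈⟨ sum-cong (divisors C) (term i≤a) ⟩
        sumP (map (λ E → (σ*-power p i *P p ^P (a ∸ i)) *P (σ* E *P quot C E)) (divisors C))
          ≈⟨ sum-*ˡ (σ*-power p i *P p ^P (a ∸ i)) (λ E → σ* E *P quot C E) (divisors C) ⟩
        (σ*-power p i *P p ^P (a ∸ i)) *P σ*⋆id C ∎

σ-power-suc : ∀ p a → σ-power p (suc a) ≋ 1P +P p *P σ-power p a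
σ-power-suc p zero = ≋-refl
σ-power-suc p (suc a) = begin
  σ-power p (suc a) +P p ^P suc (suc a)         ≈⟨ +-cong (σ-power-suc p a) ≋-refl ⟩
  (1P +P p *P σ-power p a) +P p *P p ^P suc a   ≈⟨ +-assoc 1P (p *P σ-power p a) (p *P p ^P suc a) ⟩
  1P +P (p *P σ-power p a +P p *P p ^P suc a)   ≈⟨ +-cong ≋-refl (*-distribˡ p (σ-power p a) (p ^P suc a)) ⟨
  1P +P p *P σ-power p (suc a)                  ∎
  where open ≋-Reasoning

σ-power-suc-suc : ∀ p a → σ-power p (suc (suc a)) ≋ 1P +P p *P (1P +P p *P σ-power p a)
σ-power-suc-suc p a = ≋-trans (σ-power-suc p (suc a)) (+-cong ≋-refl (*-congʳ p (σ-power-suc p a)))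

σ*⋆id-power-suc : ∀ p a → σ*⋆id-power p (suc a) ≋ p *P σ*⋆id-power p a +P σ*-power p (suc a)
σ*⋆id-power-suc p a = +-cong shifted (≋-trans (*-congʳ (σ*-power p (suc a)) p^0≈1) (*-identityʳ _))
  where
  p^0≈1 : p ^P (suc a ∸ suc a) ≋ 1P
  p^0≈1 = ≡⇒≋ (cong (p ^P_) (ℕₚ.n∸n≡0 a))
  shifted : sum≤ a (λ i → σ*-power p i *P p ^P (suc a ∸ i)) ≋ p *P σ*⋆id-power p a
  shifted = begin
    sum≤ a (λ i → σ*-power p i *P p ^P (suc a ∸ i))  ≈⟨ sum≤-cong a term ⟩
    sum≤ a (λ i → (σ*-power p i *P p ^P (a ∸ i)) *P p) ≈⟨ sum≤-*ʳ a _ p ⟩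
    σ*⋆id-power p a *P p                            ≈⟨ *-comm _ p ⟩
    p *P σ*⋆id-power p a                            ∎
    where
    open ≋-Reasoning
    term : ∀ {i} → i ≤ a → σ*-power p i *P p ^P (suc a ∸ i) ≋ (σ*-power p i *P p ^P (a ∸ i)) *P p
    term {i} i≤a = begin
      σ*-power p i *P p ^P (suc a ∸ i)       ≡⟨ cong (λ n → σ*-power p i *P p ^P n) (ℕₚ.+-∸-assoc 1 i≤a) ⟩
      σ*-power p i *P (p *P p ^P (a ∸ i))    ≈⟨ *-congʳ (σ*-power p i) (*-comm p _) ⟩
      σ*-power p i *P (p ^P (a ∸ i) *P p)    ≈⟨ *-assoc (σ*-power p i) (p ^P (a ∸ i)) p ⟨
      (σ*-power p i *P p ^P (a ∸ i)) *P p    ∎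

-- In characteristic 2, σ*⋆id(pᵃ) = σ(pᵃ) + a·pᵃ, and for odd a, 1 + p divides σ(pᵃ).
σ*⋆id-power≈σ-power⊎1+p∣σ-power : ∀ p a → σ*⋆id-power p a ≋ σ-power p a ⊎ (1P +P p) ∣ₚ σ-power p a
σ*⋆id-power≈σ-power⊎1+p∣σ-power p zero = inj₁ (*-identityˡ 1P)
σ*⋆id-power≈σ-power⊎1+p∣σ-power p (suc zero) =
  inj₂ (divides 1P (≋-trans (*-identityʳ (1P +P p)) (+-cong ≋-refl (≋-sym (*-identityʳ p)))))
σ*⋆id-power≈σ-power⊎1+p∣σ-power p (suc (suc a)) with σ*⋆id-power≈σ-power⊎1+p∣σ-power p a
... | inj₁ T≈S = inj₁ (begin
  σ*⋆id-power p (suc (suc a))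
    ≈⟨ σ*⋆id-power-suc p (suc a) ⟩
  p *P σ*⋆id-power p (suc a) +P σ*-power p (suc (suc a))
    ≈⟨ +-cong (*-congʳ p (≋-trans (σ*⋆id-power-suc p a) (+-cong (*-congʳ p T≈S) ≋-refl))) ≋-refl ⟩
  p *P (p *P σ-power p a +P (1P +P q)) +P (1P +P p *P q)
    ≈⟨ solve 3 (λ p s q → p :* (p :* s :+ (con true :+ q)) :+ (con true :+ p :* q)
                         := con true :+ p :* (con true :+ p :* s)) ≋-refl p (σ-power p a) q ⟩
  1P +P p *P (1P +P p *P σ-power p a)
    ≈⟨ σ-power-suc-suc p a ⟨
  σ-power p (suc (suc a)) ∎)
  where
  open ≋-Reasoning
  open PolySolver
  q : Poly
  q = p ^P suc a
... | inj₂ 1+p∣S = inj₂ (∣ₚ-respʳ (≋-sym S≈) (∣p∣q⇒∣p+q ∣ₚ-refl (∣p⇒∣q*p (p *P p) 1+p∣S)))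
  where
  open PolySolver
  S≈ : σ-power p (suc (suc a)) ≋ (1P +P p) +P (p *P p) *P σ-power p a
  S≈ = ≋-trans (σ-power-suc-suc p a)
         (solve 2 (λ p s → con true :+ p :* (con true :+ p :* s) := (con true :+ p) :+ (p :* p) :* s)
                  ≋-refl p (σ-power p a))

len-<-* : ∀ p {q} → 2 ≤ len p → ¬ q ≋ 0P → len q < len (p *P q)
len-<-* p {q} 2≤p q≉0 with len p in ep | ≉0⇒len≡suc q q≉0
len-<-* p {q} (s≤s (s≤s _)) q≉0 | suc (suc m) | n , eq = ℕₚ.≤-trans (ℕₚ.≤-reflexive (cong suc eq))
  (ℕₚ.≤-trans (s≤s (s≤s (ℕₚ.m≤n+m n m))) (ℕₚ.≤-reflexive (≡.sym (len-* p q (suc m) n ep eq))))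

≉0≉1⇒2≤len : ∀ {p} → ¬ p ≋ 0P → ¬ p ≋ 1P → 2 ≤ len p
≉0≉1⇒2≤len {p} p≉0 p≉1 with len p in e
... | zero = ⊥-elim (p≉0 (len≡0⇒≋0 p e))
... | suc zero = ⊥-elim (p≉1 (len≡1⇒≋1 p e))
... | suc (suc _) = s≤s (s≤s z≤n)

T-not : ∀ {b} → ¬ T b → T (not b)
T-not {false} _ = _
T-not {true} ¬T = ¬T _

¬T-not : ∀ {b} → T (not b) → ¬ T b
¬T-not {false} _ ()

∈-properNontrivialDivisors⁻ : ∀ {A D} → D ∈ properNontrivialDivisors A → D ∈ divisors A × ¬ D ≋ 1P × ¬ D ≋ A
∈-properNontrivialDivisors⁻ {A} {D} D∈ with ∈-filter⁻ (λ d → T? (not (d == 1P) ∧ not (d == A))) {xs = divisors A} D∈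
... | D∈′ , h = D∈′ , (λ D≈1 → ¬T-not (proj₁ (T-∧ .to h)) (≋⇒== D≈1))
                   , (λ D≈A → ¬T-not (proj₂ (T-∧ .to h)) (≋⇒== D≈A))
  where open Equivalence

∈-properNontrivialDivisors⁺ : ∀ {A D} → D ∈ divisors A → ¬ D ≋ 1P → ¬ D ≋ A → D ∈ properNontrivialDivisors A
∈-properNontrivialDivisors⁺ {A} {D} D∈ D≉1 D≉A = ∈-filter⁺ (λ d → T? (not (d == 1P) ∧ not (d == A))) D∈
  (T-∧ .from (T-not (D≉1 ∘ ==⇒≋) , T-not (D≉A ∘ ==⇒≋)))
  where open Equivalence

proper-divisor-len< : ∀ {A D} → ¬ A ≋ 0P → D ∣ₚ A → ¬ D ≋ A → len D < len A
proper-divisor-len< {A} {D} A≉0 (divides q Dq≈A) D≉A =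
  ℕₚ.≤-trans (len-<-* q 2≤q D≉0) (ℕₚ.≤-reflexive (≋⇒len≡ (≋-trans (*-comm q D) Dq≈A)))
  where
  D≉0 : ¬ D ≋ 0P
  D≉0 = ∣ₚ⇒≉0 (divides q Dq≈A) A≉0
  2≤q : 2 ≤ len q
  2≤q = ≉0≉1⇒2≤len (quotient-≉0 {D} (divides q Dq≈A) A≉0)
          (λ q≈1 → D≉A (≋-trans (≋-sym (≋-trans (*-congʳ D q≈1) (*-identityʳ D))) Dq≈A))

irreducible-factor : ∀ A → 2 ≤ len A → Σ Poly λ p → Irreducible p × p ∣ₚ A
irreducible-factor A = go A (<-wellFounded (len A))
  where
  go : ∀ A → Acc _<_ (len A) → 2 ≤ len A → Σ Poly λ p → Irreducible p × p ∣ₚ A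
  go A (acc rec) 2≤A with properNontrivialDivisors A in eq
  ... | [] = A , (2≤A , trivial-divisors) , ∣ₚ-refl
    where
    A≉0 : ¬ A ≋ 0P
    A≉0 = len≥2⇒≉0 {A} 2≤A
    trivial-divisors : ∀ d → d ∣ A → d ≈ 1P ⊎ d ≈ A
    trivial-divisors d d∣A with norm d ≋? 1P | norm d ≋? A
    ... | yes nd≈1 | _ = inj₁ (≋⇒≈ (≋-trans (≋-sym (norm-≋ d)) nd≈1))
    ... | no _ | yes nd≈A = inj₂ (≋⇒≈ (≋-trans (≋-sym (norm-≋ d)) nd≈A))
    ... | no nd≉1 | no nd≉A with ≡.subst (norm d ∈_) eq (∈-properNontrivialDivisors⁺ {A}
          (∈-divisors⁺ A≉0 (norm-idem d) (∣ₚ-respˡ (≋-sym (norm-≋ d)) (∣⇒∣ₚ d∣A))) nd≉1 nd≉A)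
    ... | ()
  ... | d ∷ _ with ∈-properNontrivialDivisors⁻ {A} (≡.subst (d ∈_) (≡.sym eq) (here ≡.refl))
  ... | d∈ , d≉1 , d≉A =
    let A≉0 = len≥2⇒≉0 {A} 2≤A
        d∣A = proj₂ (∈-divisors⁻ A d∈)
        (p , p-irr , p∣d) = go d (rec (proper-divisor-len< A≉0 d∣A d≉A)) (≉0≉1⇒2≤len (∣ₚ⇒≉0 d∣A A≉0) d≉1)
    in p , p-irr , ∣ₚ-trans p∣d d∣A

p-part : ∀ {p} → Irreducible p → ∀ A → ¬ A ≋ 0P → Σ ℕ λ a → Σ Poly λ C → A ≋ p ^P a *P C × ¬ p ∣ₚ C
p-part {p} p-irr A = go A (<-wellFounded (len A))
  where
  go : ∀ A → Acc _<_ (len A) → ¬ A ≋ 0P → Σ ℕ λ a → Σ Poly λ C → A ≋ p ^P a *P C × ¬ p ∣ₚ C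
  go A (acc rec) A≉0 with (p ∣? irreducible⇒≉0 {p} p-irr) A
  ... | no p∤A = 0 , A , ≋-sym (*-identityˡ A) , p∤A
  ... | yes (divides A′ pA′≈A) =
    let A′≉0 = quotient-≉0 {p} (divides A′ pA′≈A) A≉0
        A′<A = ℕₚ.≤-trans (len-<-* p (proj₁ p-irr) A′≉0) (ℕₚ.≤-reflexive (≋⇒len≡ pA′≈A))
        (a , C , A′≈ , p∤C) = go A′ (rec A′<A) A′≉0
    in suc a , C , ≋-trans (≋-sym pA′≈A) (≋-trans (*-congʳ p A′≈) (≋-sym (*-assoc p (p ^P a) C))) , p∤C

X : Poly
X = false ∷ true ∷ []

X-irreducible : Irreducible X
X-irreducible = s≤s (s≤s z≤n) , λ d d∣X → only-trivial (∣⇒∣ₚ {d} d∣X)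
  where
  X≉0 : ¬ X ≋ 0P
  X≉0 ()
  only-trivial : ∀ {d} → d ∣ₚ X → d ≈ 1P ⊎ d ≈ X
  only-trivial {d} d∣X with d ≋? 1P | d ≋? X
  ... | yes d≈1 | _ = inj₁ (≋⇒≈ d≈1)
  ... | no _ | yes d≈X = inj₂ (≋⇒≈ d≈X)
  ... | no d≉1 | no d≉X = ⊥-elim (ℕₚ.<⇒≱ (proper-divisor-len< X≉0 d∣X d≉X) 2≤d)
    where
    2≤d : 2 ≤ len d
    2≤d = ≉0≉1⇒2≤len (∣ₚ⇒≉0 d∣X X≉0) d≉1

X*-≋-shift : ∀ q → X *P q ≋ false ∷ q
X*-≋-shift q = ∷-cong false (≋-trans (+-cong ≋-refl (false∷-≋0 ≋-refl)) (+-identityʳ q))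

X∣p⊎X∣1+p : ∀ p → X ∣ₚ p ⊎ X ∣ₚ 1P +P p
X∣p⊎X∣1+p [] = inj₁ (divides 0P (*-zeroʳ X))
X∣p⊎X∣1+p (false ∷ q) = inj₁ (divides q (X*-≋-shift q))
X∣p⊎X∣1+p (true ∷ q) = inj₂ (divides q (X*-≋-shift q))

-- σ*⋆id = σ away from x

module _ {A} (A≈1 : A ≋ 1P) where

  private
    A≉0 : ¬ A ≋ 0P
    A≉0 A≈0 with ≋-trans (≋-sym A≈1) A≈0
    ... | ()

    divisors-of-unit : ∀ (h : Poly → Poly) → sumP (map h (divisors A)) ≋ h 1P +P 0P
    divisors-of-unit h = sum-over-same-elements h (divisors-unique A) ([] ∷ []) is-1 (λ { (here ≡.refl) → 1∈ })
      where
      1∈ : 1P ∈ divisors A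
      1∈ = ∈-divisors⁺ A≉0 ≡.refl (1∣ₚ A)
      is-1 : ∀ {x} → x ∈ divisors A → x ∈ 1P ∷ []
      is-1 {x} x∈ with ∈-divisors⁻ A x∈
      ... | x-normal , x∣A = here (≋⇒≡ x-normal ≡.refl (len≡1⇒≋1 x (ℕₚ.≤-antisym x≤1 1≤x)))
        where
        x≤1 : len x ≤ 1
        x≤1 = ℕₚ.≤-trans (∣ₚ⇒len≤ x∣A A≉0) (ℕₚ.≤-reflexive (≋⇒len≡ A≈1))
        1≤x : 1 ≤ len x
        1≤x = let (_ , e) = ≉0⇒len≡suc x (∣ₚ⇒≉0 x∣A A≉0) in ≡.subst (1 ≤_) (≡.sym e) (s≤s z≤n)

  σ*⋆id-unit : σ*⋆id A ≋ σ A
  σ*⋆id-unit = begin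
    σ*⋆id A                          ≈⟨ divisors-of-unit _ ⟩
    σ* 1P *P quot A 1P +P 0P         ≈⟨ +-identityʳ _ ⟩
    1P *P quot A 1P                  ≈⟨ *-identityˡ _ ⟩
    quot A 1P                        ≈⟨ quot-unique {d = 1P} A≉0 (*-identityˡ A) ⟩
    A                                ≈⟨ A≈1 ⟩
    1P                               ≈⟨ +-identityʳ 1P ⟨
    1P +P 0P                         ≈⟨ divisors-of-unit (λ x → x) ⟨
    sumP (map (λ x → x) (divisors A)) ≡⟨ cong sumP (map-id (divisors A)) ⟩
    σ A                              ∎
    where open ≋-Reasoning

σ*⋆id≈σ : ∀ A → ¬ A ≋ 0P → ¬ X ∣ₚ A → ¬ X ∣ₚ σ A → σ*⋆id A ≋ σ A
σ*⋆id≈σ A = go A (<-wellFounded (len A))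
  where
  go : ∀ A → Acc _<_ (len A) → ¬ A ≋ 0P → ¬ X ∣ₚ A → ¬ X ∣ₚ σ A → σ*⋆id A ≋ σ A
  go A (acc rec) A≉0 X∤A X∤σA with A ≋? 1P
  ... | yes A≈1 = σ*⋆id-unit A≈1
  ... | no A≉1 with irreducible-factor A (≉0≉1⇒2≤len A≉0 A≉1)
  ... | p , p-irr , p∣A with p-part {p} p-irr A A≉0
  ... | zero , C , A≈1*C , p∤C = ⊥-elim (p∤C (∣ₚ-respʳ (≋-trans A≈1*C (*-identityˡ C)) p∣A))
  ... | suc a , C , A≈p^a*C , p∤C = from-dichotomy (σ*⋆id-power≈σ-power⊎1+p∣σ-power p (suc a))
    where
    C∣A : C ∣ₚ A
    C∣A = divides (p ^P suc a) (≋-trans (*-comm C (p ^P suc a)) (≋-sym A≈p^a*C))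
    C≉0 : ¬ C ≋ 0P
    C≉0 = ∣ₚ⇒≉0 {C} C∣A A≉0
    open DivisorsOfPower {p} p-irr C≉0 p∤C
    σA≈ : σ A ≋ σ-power p (suc a) *P σ C
    σA≈ = σ-p^a* {suc a} A≈p^a*C
    IH : σ*⋆id C ≋ σ C
    IH = go C (rec (proper-divisor-len< A≉0 C∣A (λ C≈A → p∤C (∣ₚ-respʳ (≋-sym C≈A) p∣A)))) C≉0
            (λ X∣C → X∤A (∣ₚ-trans X∣C C∣A))
            (λ X∣σC → X∤σA (∣ₚ-respʳ (≋-sym σA≈) (∣p⇒∣q*p (σ-power p (suc a)) X∣σC)))
    from-dichotomy : σ*⋆id-power p (suc a) ≋ σ-power p (suc a) ⊎ (1P +P p) ∣ₚ σ-power p (suc a) →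
                     σ*⋆id A ≋ σ A
    from-dichotomy (inj₁ T≈S) = ≋-trans (σ*⋆id-p^a* {suc a} A≈p^a*C) (≋-trans (*-cong T≈S IH) (≋-sym σA≈))
    from-dichotomy (inj₂ 1+p∣S) with X∣p⊎X∣1+p p
    ... | inj₁ X∣p = ⊥-elim (X∤A (∣ₚ-trans X∣p p∣A))
    ... | inj₂ X∣1+p = ⊥-elim (X∤σA (∣ₚ-respʳ (≋-sym σA≈) (∣p⇒∣p*q (σ C) (∣ₚ-trans X∣1+p 1+p∣S))))

sumF-common-denominator : ∀ (f : Poly → Poly) A (M : List Poly) → (∀ {D} → D ∈ M → D *P quot A D ≋ A) →
  let (N , P) = sumF (map (λ D → f D , D) M) in N *P A ≋ sumP (map (λ D → f D *P quot A D) M) *P P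
sumF-common-denominator f A [] _ = ≋-refl
sumF-common-denominator f A (D ∷ M) D*quot≈A = begin
  (f D *P P +P N *P D) *P A
    ≈⟨ solve 5 (λ f P N D A → (f :* P :+ N :* D) :* A := f :* P :* A :+ (N :* A) :* D) ≋-refl (f D) P N D A ⟩
  f D *P P *P A +P (N *P A) *P D
    ≈⟨ +-cong (*-congʳ (f D *P P) (≋-sym (D*quot≈A (here ≡.refl)))) (*-congˡ D IH) ⟩
  f D *P P *P (D *P Q) +P (S *P P) *P D
    ≈⟨ solve 5 (λ f P D Q S → f :* P :* (D :* Q) :+ (S :* P) :* D := (f :* Q :+ S) :* (D :* P)) ≋-refl (f D) P D Q S ⟩
  (f D *P Q +P S) *P (D *P P) ∎
  where
  open ≋-Reasoning
  open PolySolver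
  N P S Q : Poly
  N = proj₁ (sumF (map (λ D → f D , D) M))
  P = proj₂ (sumF (map (λ D → f D , D) M))
  S = sumP (map (λ D → f D *P quot A D) M)
  Q = quot A D
  IH : N *P A ≋ S *P P
  IH = sumF-common-denominator f A M (λ D∈ → D*quot≈A (there D∈))

T-not-∧-not⁻ : ∀ a b → T (not (not a ∧ not b)) → T a ⊎ T b
T-not-∧-not⁻ true  b _ = inj₁ _
T-not-∧-not⁻ false true _ = inj₂ _

T-not-∧-not⁺ʳ : ∀ a {b} → T b → T (not (not a ∧ not b))
T-not-∧-not⁺ʳ true  _ = _
T-not-∧-not⁺ʳ false {true} _ = _

module _ {A} (A-nonconstant : Nonconstant A) where

  private
    A≉0 : ¬ A ≋ 0P
    A≉0 = len≥2⇒≉0 {A} A-nonconstant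

    proper? : Poly → Bool
    proper? d = not (d == 1P) ∧ not (d == A)

    h : Poly → Poly
    h D = σ* D *P quot A D

    improper : List Poly
    improper = filterᵇ (not ∘ proper?) (divisors A)

    1≢normA : 1P ≢ norm A
    1≢normA 1≡A with ≡.subst (λ l → 2 ≤ length l) (≡.sym 1≡A) A-nonconstant
    ... | s≤s ()

    improper⊆ : ∀ {x} → x ∈ improper → x ∈ 1P ∷ norm A ∷ []
    improper⊆ {x} x∈ with ∈-filter⁻ (λ d → T? (not (proper? d))) {xs = divisors A} x∈
    ... | x∈′ , trivial with T-not-∧-not⁻ (x == 1P) (x == A) trivial
    ... | inj₁ x==1 = here (≋⇒≡ (proj₁ (∈-divisors⁻ A x∈′)) ≡.refl (==⇒≋ x==1))
    ... | inj₂ x==A =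
      there (here (≋⇒≡ (proj₁ (∈-divisors⁻ A x∈′)) (norm-idem A) (≋-trans (==⇒≋ x==A) (≋-sym (norm-≋ A)))))

    ⊆improper : ∀ {x} → x ∈ 1P ∷ norm A ∷ [] → x ∈ improper
    ⊆improper (here ≡.refl) = ∈-filter⁺ (λ d → T? (not (proper? d))) (∈-divisors⁺ A≉0 ≡.refl (1∣ₚ A)) _
    ⊆improper (there (here ≡.refl)) = ∈-filter⁺ (λ d → T? (not (proper? d)))
      (∈-divisors⁺ A≉0 (norm-idem A) (≋⇒∣ₚ (norm-≋ A))) (T-not-∧-not⁺ʳ (norm A == 1P) (≋⇒== (norm-≋ A)))

    sum-improper : sumP (map h improper) ≋ A +P σ* A
    sum-improper = begin
      sumP (map h improper)
        ≈⟨ sum-over-same-elements h (Unique.filter⁺ (λ d → T? (not (proper? d))) (divisors-unique A))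
             ((1≢normA ∷ []) ∷ [] ∷ []) improper⊆ ⊆improper ⟩
      h 1P +P (h (norm A) +P 0P)  ≈⟨ +-cong h1≈A (≋-trans (+-identityʳ _) hA≈σ*A) ⟩
      A +P σ* A                   ∎
      where
      open ≋-Reasoning
      h1≈A : h 1P ≋ A
      h1≈A = ≋-trans (*-identityˡ (quot A 1P)) (quot-unique {d = 1P} A≉0 (*-identityˡ A))
      hA≈σ*A : h (norm A) ≋ σ* A
      hA≈σ*A = ≋-trans (*-cong (σ*-cong (λ z → A≉0 (≋-trans (≋-sym (norm-≋ A)) z)) (norm-≋ A))
                               (quot-unique {d = norm A} A≉0 (≋-trans (*-identityʳ (norm A)) (norm-≋ A))))
                       (*-identityʳ (σ* A))

    σ*⋆id-split : σ*⋆id A ≋ sumP (map h (properNontrivialDivisors A)) +P (A +P σ* A)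
    σ*⋆id-split = ≋-trans (sum-filter proper? h (divisors A)) (+-cong ≋-refl sum-improper)

  proper-divisor*quot : ∀ {D} → D ∈ properNontrivialDivisors A → D *P quot A D ≋ A
  proper-divisor*quot D∈ = quot-correct A≉0 (proj₂ (∈-divisors⁻ A (proj₁ (∈-properNontrivialDivisors⁻ {A} D∈))))

  sum-proper : σ*⋆id A ≋ A → sumP (map (λ D → σ* D *P quot A D) (properNontrivialDivisors A)) ≋ σ* A
  sum-proper σ*⋆id≈A = begin
    S                                  ≈⟨ solve 2 (λ s t → s := (s :+ t) :+ t) ≋-refl S (A +P σ* A) ⟩
    (S +P (A +P σ* A)) +P (A +P σ* A)  ≈⟨ +-cong (≋-trans (≋-sym σ*⋆id-split) σ*⋆id≈A) ≋-refl ⟩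
    A +P (A +P σ* A)                   ≈⟨ solve 2 (λ a t → a :+ (a :+ t) := t) ≋-refl A (σ* A) ⟩
    σ* A                               ∎
    where
    open ≋-Reasoning
    open PolySolver
    S : Poly
    S = sumP (map h (properNontrivialDivisors A))

σ*⋆id-odd-perfect : ∀ {A} → Odd A → Perfect A → σ*⋆id A ≋ A
σ*⋆id-odd-perfect {A} (A≉0 , no-linear-factor) A-perfect =
  ≋-trans (σ*⋆id≈σ A (A≉0 ∘ ≋⇒≈) X∤A (X∤A ∘ ∣ₚ-respʳ σA≈A)) σA≈A
  where
  σA≈A : σ A ≋ A
  σA≈A = mk≋ A-perfect
  X∤A : ¬ X ∣ₚ A
  X∤A X∣A = no-linear-factor X X-irreducible ≡.refl (∣ₚ⇒∣ X∣A)

corollary3p22 : (A : Poly) → Nonconstant A → Odd A → Perfect A →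
    sumF (map (λ D → (σ* D , D)) (properNontrivialDivisors A)) ≈F (σ* A , A)
corollary3p22 A A-nonconstant A-odd A-perfect = ≋⇒≈ (begin
  proj₁ F *P A     ≈⟨ sumF-common-denominator σ* A M (proper-divisor*quot {A} A-nonconstant) ⟩
  S *P proj₂ F     ≈⟨ *-congˡ (proj₂ F) (sum-proper {A} A-nonconstant (σ*⋆id-odd-perfect A-odd A-perfect)) ⟩
  σ* A *P proj₂ F  ∎)
  where
  open ≋-Reasoning
  M : List Poly
  M = properNontrivialDivisors A
  F : Frac
  F = sumF (map (λ D → σ* D , D) M)
  S : Poly
  S = sumP (map (λ D → σ* D *P quot A D) M)
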